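{- For every letter $n>0$, the word $\alpha(0n)$ generates $\alpha(0n0)$, i.e. $L(\alpha(0)\alpha(n))=L(\alpha(0)\alpha(n)\alpha(0))$.
   Context: All words are over $\mathbb{N}=\{0,1,2,\dots\}$; letters are written as numerals (e.g. $202101$ has letters $2,0,2,1,0,1$). Positions are indexed from $0$; $w[i:j]=w[i]\cdots w[j-1]$, $w[:j]=w[0:j]$, negative indices count from the end ($w[:-k]$ deletes the last $k$ letters, $w[-k:]$ is the suffix of length $k$). For nonempty finite $w$, $w^+$ is $w$ with its last letter increased by $1$. A square is a nonempty word $yy$. For words $u,v$, $u\prec v$ means there is $i$ with $u[:i]=v[:i]$ and $u[i]<v[i]$. For a finite word $w$, $L(w)$ is the lexicographically least infinite word over $\mathbb{N}$ beginning with $w$ whose only square factors are contained in the prefix $w$. A word $p$ generates $ps$ if $L(p)=L(ps)$. The ruler morphism is $\rho(n)=0\,(n+1)$ and $R_n=\rho^n(0)$ (prefix of length $2^n$ of $0102010301020104\cdots$). Define $P_0(n)=R_{n+1}[:-2]$. Define the morphism $\psi_1$ by $\psi_1(0)=202101$, $\psi_1(n)=(n+1)P_0(n+1)$ for $n\ge1$; $P_1(n)=\psi_1(P_0(n-1))$. Define the morphism $\psi_2$ by $\psi_2(n)=(n+2)P_0(n+2)P_1(n+2)$ for $n\ge1$ and $\psi_2(0)$ equal to the 199-letter word 2021020102101201020120210120102013010201030102012021012010201 2021013010201030102012021012010201202301020103010201202101201 0201203010201030102030103020102030102010301020301030201202101 2010201202101202 (concatenate the pieces). Let $C=0102030102$,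 $B_0=0301\,\psi_1(1010)[:-3]\,\psi_2(1010)[:-6]\,\psi_2(10)[:-12]\,301020$, $B_1=\rho(B_0[7:-5])$, $E=0102\,B_0\,1\,B_0[:-9]$, $F=B_0[-9:]\,3010302\,C\,0103\,C^+\,02$. The morphism $\alpha$ is defined by $\alpha(0)=EFE$, $\alpha(1)=B_1R_4CB_1R_4$, and $\alpha(n)=\alpha(n-1)^+R_{n+3}C\alpha(n-1)^+R_{n+3}$ for $n\ge2$. -}

module Defs where

open import Data.Nat using (ℕ; zero; suc; _+_; _∸_; _≤_; _<_)
open import Data.List using (List; []; _∷_; _++_; length; take; drop; concatMap)
open import Data.Product using (Σ; _×_; _,_)
open import Relation.Binary.PropositionalEquality using (_≡_)
open import Relation.Nullary using (¬_)
open import Function.Bundles using (_⇔_)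

Word : Set
Word = List ℕ

InfWord : Set
InfWord = ℕ → ℕ

pre : InfWord → ℕ → Word
pre x zero    = []
pre x (suc n) = x 0 ∷ pre (λ i → x (suc i)) n

dropLast : ℕ → Word → Word
dropLast k w = take (length w ∸ k) w

suffix : ℕ → Word → Word
suffix k w = drop (length w ∸ k) w

-- w^+ : last letter increased by 1 (identity on the empty word, never used)
_⁺ : Word → Word
[] ⁺ = []
(a ∷ []) ⁺ = suc a ∷ []
(a ∷ b ∷ w) ⁺ = a ∷ ((b ∷ w) ⁺)

apply : (ℕ → Word) → Word → Word
apply f w = concatMap f w

ρ : ℕ → Word
ρ n = 0 ∷ suc n ∷ []

R : ℕ → Word
R zero    = 0 ∷ []
R (suc n) = apply ρ (R n)

SquareAt : InfWord → ℕ → ℕ → Set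
SquareAt x i k = (0 < k) × (∀ j → j < k → x (i + j) ≡ x (i + k + j))

Admissible : Word → InfWord → Set
Admissible w x = (pre x (length w) ≡ w)
               × (∀ i k → SquareAt x i k → i + (k + k) ≤ length w)

_≺_ : InfWord → InfWord → Set
y ≺ x = Σ ℕ (λ i → (∀ j → j < i → y j ≡ x j) × (y i < x i))

IsL : Word → InfWord → Set
IsL w x = Admissible w x × (∀ y → Admissible w y → ¬ (y ≺ x))

Generates : Word → Word → Set
Generates p q = ∀ x → IsL p x ⇔ IsL q x

P₀ : ℕ → Word
P₀ n = dropLast 2 (R (suc n))

ψ₁ : ℕ → Word
ψ₁ zero    = 2 ∷ 0 ∷ 2 ∷ 1 ∷ 0 ∷ 1 ∷ []
ψ₁ (suc n) = (suc (suc n)) ∷ P₀ (suc (suc n))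

P₁ : ℕ → Word
P₁ n = apply ψ₁ (P₀ (n ∸ 1))

ψ₂zero : Word
ψ₂zero = 2 ∷ 0 ∷ 2 ∷ 1 ∷ 0 ∷ 2 ∷ 0 ∷ 1 ∷ 0 ∷ 2 ∷ 1 ∷ 0 ∷ 1 ∷ 2 ∷ 0 ∷ 1 ∷ 0 ∷ 2 ∷ 0 ∷ 1 ∷ 2 ∷ 0 ∷ 2 ∷ 1 ∷ 0 ∷ 1 ∷ 2 ∷ 0 ∷ 1 ∷ 0 ∷ 2 ∷ 0 ∷ 1 ∷ 3 ∷ 0 ∷ 1 ∷ 0 ∷ 2 ∷ 0 ∷ 1 ∷ 0 ∷ 3 ∷ 0 ∷ 1 ∷ 0 ∷ 2 ∷ 0 ∷ 1 ∷ 2 ∷ 0 ∷ 2 ∷ 1 ∷ 0 ∷ 1 ∷ 2 ∷ 0 ∷ 1 ∷ 0 ∷ 2 ∷ 0 ∷ 1 ∷ 2 ∷ 0 ∷ 2 ∷ 1 ∷ 0 ∷ 1 ∷ 3 ∷ 0 ∷ 1 ∷ 0 ∷ 2 ∷ 0 ∷ 1 ∷ 0 ∷ 3 ∷ 0 ∷ 1 ∷ 0 ∷ 2 ∷ 0 ∷ 1 ∷ 2 ∷ 0 ∷ 2 ∷ 1 ∷ 0 ∷ 1 ∷ 2 ∷ 0 ∷ 1 ∷ 0 ∷ 2 ∷ 0 ∷ 1 ∷ 2 ∷ 0 ∷ 2 ∷ 3 ∷ 0 ∷ 1 ∷ 0 ∷ 2 ∷ 0 ∷ 1 ∷ 0 ∷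 3 ∷ 0 ∷ 1 ∷ 0 ∷ 2 ∷ 0 ∷ 1 ∷ 2 ∷ 0 ∷ 2 ∷ 1 ∷ 0 ∷ 1 ∷ 2 ∷ 0 ∷ 1 ∷ 0 ∷ 2 ∷ 0 ∷ 1 ∷ 2 ∷ 0 ∷ 3 ∷ 0 ∷ 1 ∷ 0 ∷ 2 ∷ 0 ∷ 1 ∷ 0 ∷ 3 ∷ 0 ∷ 1 ∷ 0 ∷ 2 ∷ 0 ∷ 3 ∷ 0 ∷ 1 ∷ 0 ∷ 3 ∷ 0 ∷ 2 ∷ 0 ∷ 1 ∷ 0 ∷ 2 ∷ 0 ∷ 3 ∷ 0 ∷ 1 ∷ 0 ∷ 2 ∷ 0 ∷ 1 ∷ 0 ∷ 3 ∷ 0 ∷ 1 ∷ 0 ∷ 2 ∷ 0 ∷ 3 ∷ 0 ∷ 1 ∷ 0 ∷ 3 ∷ 0 ∷ 2 ∷ 0 ∷ 1 ∷ 2 ∷ 0 ∷ 2 ∷ 1 ∷ 0 ∷ 1 ∷ 2 ∷ 0 ∷ 1 ∷ 0 ∷ 2 ∷ 0 ∷ 1 ∷ 2 ∷ 0 ∷ 2 ∷ 1 ∷ 0 ∷ 1 ∷ 2 ∷ 0 ∷ 2 ∷ []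

ψ₂ : ℕ → Word
ψ₂ zero    = ψ₂zero
ψ₂ (suc n) = (suc n + 2) ∷ (P₀ (suc n + 2) ++ P₁ (suc n + 2))

C : Word
C = 0 ∷ 1 ∷ 0 ∷ 2 ∷ 0 ∷ 3 ∷ 0 ∷ 1 ∷ 0 ∷ 2 ∷ []

B₀ : Word
B₀ = (0 ∷ 3 ∷ 0 ∷ 1 ∷ [])
   ++ dropLast 3 (apply ψ₁ (1 ∷ 0 ∷ 1 ∷ 0 ∷ []))
   ++ dropLast 6 (apply ψ₂ (1 ∷ 0 ∷ 1 ∷ 0 ∷ []))
   ++ dropLast 12 (apply ψ₂ (1 ∷ 0 ∷ []))
   ++ (3 ∷ 0 ∷ 1 ∷ 0 ∷ 2 ∷ 0 ∷ [])

B₁ : Word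
B₁ = apply ρ (drop 7 (dropLast 5 B₀))

E : Word
E = (0 ∷ 1 ∷ 0 ∷ 2 ∷ []) ++ B₀ ++ (1 ∷ []) ++ dropLast 9 B₀

F : Word
F = suffix 9 B₀ ++ (3 ∷ 0 ∷ 1 ∷ 0 ∷ 3 ∷ 0 ∷ 2 ∷ []) ++ C
  ++ (0 ∷ 1 ∷ 0 ∷ 3 ∷ []) ++ (C ⁺) ++ (0 ∷ 2 ∷ [])

α : ℕ → Word
α zero          = E ++ F ++ E
α (suc zero)    = B₁ ++ R 4 ++ C ++ B₁ ++ R 4
α (suc (suc n)) = (α (suc n) ⁺) ++ R (suc (suc n) + 3) ++ C
                  ++ (α (suc n) ⁺) ++ R (suc (suc n) + 3)

{-# OPTIONS --safe #-}
module Submission where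

-- Write A = α 0 and W = α n.  If no square of A W A ends after A W, and every letter of the
-- appended A is the least one not completing a square, then A W A is the greedy continuation
-- of A W, and the least admissible words for A W and for A W A coincide.  The greedy property
-- is checked by evaluation inside A, except for two letters whose square reaches back into W.
-- Since A is square-free with letters below N = n + 3, which ends W, a square ending after A W
-- must straddle that final N, with an earlier N as the partner.  For n = 1 these squares are
-- excluded by evaluation.  For n ≥ 2, W = X R C X R with X = u 2 D N, R = 010201 D N and all
-- letters of u and D below N, so the only candidate partners are the three earlier segment
-- ends, and each is refuted by one mismatch just after it, against the start of A, or just
-- before it.

open import Defs
open import Data.Nat
open import Data.Nat.Properties
open import Data.Nat.Tactic.RingSolver using (solve-∀)
open import Data.Bool using (Bool; true; false; T; _∧_; _∨_; not)
open import Data.Bool.Properties using (T-≡; T-∧; T-∨; T-not-≡)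
open import Data.List using ([]; _∷_; _++_; length; take; drop; reverse; _ʳ++_)
open import Data.List.Properties
  using (length-++; ++-assoc; ++-identityʳ; ++-monoid; ∷ʳ-++; length-take; length-drop; length-reverse;
         take++drop≡id; ʳ++-defn; reverse-++; reverse-involutive; unfold-reverse; concatMap-++)
open import Data.List.Relation.Unary.All as All using (All; []; _∷_; all?)
open import Data.List.Relation.Unary.All.Properties using (++⁺)
open import Data.List.Extrema.Nat using (max; xs≤max)
open import Data.Product using (Σ; _×_; _,_; proj₁; proj₂)
open import Data.Sum using (_⊎_; inj₁; inj₂; map; map₁)
open import Data.Empty using (⊥; ⊥-elim)
open import Data.Unit using (tt)
open import Relation.Nullary using (¬_; yes; no)
open import Relation.Nullary.Decidable using (toWitness)
open import Relation.Binary.PropositionalEquality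
open import Relation.Binary.Definitions using (tri<; tri≈; tri>)
open import Function.Bundles using (Equivalence; mk⇔)
open import Algebra.Solver.Monoid (++-monoid ℕ) using (_⊜_; _⊕_) renaming (solve to ++-solve)

open Equivalence using (to; from)

-- Past the end of w, w ! i is the junk value 0.
infixl 20 _!_

_!_ : Word → ℕ → ℕ
[]      ! _     = 0
(a ∷ w) ! zero  = a
(a ∷ w) ! suc i = w ! i

!-++ˡ : ∀ u {v i} → i < length u → (u ++ v) ! i ≡ u ! i
!-++ˡ (a ∷ u) {i = zero}  _         = refl
!-++ˡ (a ∷ u) {i = suc i} (s≤s i<u) = !-++ˡ u i<u

!-++ʳ : ∀ u {v} i → (u ++ v) ! (length u + i) ≡ v ! i
!-++ʳ []      i = refl
!-++ʳ (a ∷ u) i = !-++ʳ u i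

!-++-∷ : ∀ u {a v} → (u ++ a ∷ v) ! length u ≡ a
!-++-∷ []      = refl
!-++-∷ (b ∷ u) = !-++-∷ u

!-take : ∀ n w {i} → i < n → take n w ! i ≡ w ! i
!-take (suc n) []      _         = refl
!-take (suc n) (a ∷ w) {zero}  _ = refl
!-take (suc n) (a ∷ w) {suc i} (s≤s i<n) = !-take n w i<n

!-drop : ∀ n w i → drop n w ! i ≡ w ! (n + i)
!-drop zero    w       i = refl
!-drop (suc n) []      i = refl
!-drop (suc n) (a ∷ w) i = !-drop n w i

drop-suc : ∀ i (w : Word) → drop 1 (drop i w) ≡ drop (suc i) w
drop-suc zero    w       = refl
drop-suc (suc i) []      = refl
drop-suc (suc i) (a ∷ w) = drop-suc i w

drop-++ˡ : ∀ {n} (u v : Word) → n ≤ length u → drop n (u ++ v) ≡ drop n u ++ v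
drop-++ˡ {zero}  u       v _         = refl
drop-++ˡ {suc n} (a ∷ u) v (s≤s n≤u) = drop-++ˡ u v n≤u

take-++ʳ : ∀ (u v : Word) n → take (length u + n) (u ++ v) ≡ u ++ take n v
take-++ʳ []      v n = refl
take-++ʳ (a ∷ u) v n = cong (a ∷_) (take-++ʳ u v n)

length-∷ʳ : ∀ (w : Word) {a} → length (w ++ a ∷ []) ≡ suc (length w)
length-∷ʳ w = trans (length-++ w) (+-comm (length w) 1)

!-∷ʳ-++ : ∀ w {a v} → ((w ++ a ∷ []) ++ v) ! length w ≡ a
!-∷ʳ-++ w {a} {v} = trans (cong (λ u → u ! length w) (∷ʳ-++ w a v)) (!-++-∷ w)

length-take-≤ : ∀ {n} (w : Word) → n ≤ length w → length (take n w) ≡ n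
length-take-≤ {n} w n≤w = trans (length-take n w) (m≤n⇒m⊓n≡m n≤w)

!-reverse : ∀ w {r j} → r + suc j ≡ length w → reverse w ! r ≡ w ! j
!-reverse []      {r} {j} r+1+j≡0 = ⊥-elim (1+n≢0 (trans (sym (+-suc r j)) r+1+j≡0))
!-reverse (a ∷ w) {r} {zero} r+1≡ = begin
  reverse (a ∷ w) ! r            ≡⟨ cong (λ v → v ! r) (unfold-reverse a w) ⟩
  (reverse w ++ a ∷ []) ! r      ≡⟨ cong ((reverse w ++ a ∷ []) !_) r≡ ⟩
  (reverse w ++ a ∷ []) ! length (reverse w) ≡⟨ !-++-∷ (reverse w) ⟩
  a                              ∎
  where
  open ≡-Reasoning
  r≡ : r ≡ length (reverse w)
  r≡ = trans (suc-injective (trans (+-comm 1 r) r+1≡)) (sym (length-reverse w))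
!-reverse (a ∷ w) {r} {suc j} r+2+j≡ = begin
  reverse (a ∷ w) ! r            ≡⟨ cong (λ v → v ! r) (unfold-reverse a w) ⟩
  (reverse w ++ a ∷ []) ! r      ≡⟨ !-++ˡ (reverse w) r<w ⟩
  reverse w ! r                  ≡⟨ !-reverse w r+1+j≡ ⟩
  w ! j                          ∎
  where
  open ≡-Reasoning
  r+1+j≡ : r + suc j ≡ length w
  r+1+j≡ = suc-injective (trans (sym (+-suc r (suc j))) r+2+j≡)
  r<w : r < length (reverse w)
  r<w = subst (r <_) (sym (length-reverse w)) (subst (r <_) r+1+j≡ (m<m+n r z<s))

All-! : ∀ {P : ℕ → Set} {w i} → All P w → i < length w → P (w ! i)
All-! {i = zero}  (pa ∷ _)  _         = pa
All-! {i = suc i} (_ ∷ pw) (s≤s i<w) = All-! pw i<w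

≢-via : ∀ {x y a c : ℕ} → x ≡ a → y ≡ c → a ≢ c → x ≢ y
≢-via x≡a y≡c a≢c x≡y = a≢c (trans (sym x≡a) (trans x≡y y≡c))

≤-by : ∀ {m n} o → m + o ≡ n → m ≤ n
≤-by {m} o m+o≡n = subst (m ≤_) m+o≡n (m≤m+n m o)

All<-weaken : ∀ {m n w} → m ≤ n → All (_< m) w → All (_< n) w
All<-weaken m≤n = All.map (λ a<m → <-≤-trans a<m m≤n)

AgreeBelow : ℕ → InfWord → InfWord → Set
AgreeBelow n x y = ∀ j → j < n → x j ≡ y j

agreeBelow-mono : ∀ {m n x y} → m ≤ n → AgreeBelow n x y → AgreeBelow m x y
agreeBelow-mono m≤n agree j j<m = agree j (<-≤-trans j<m m≤n)

agreeBelow-suc : ∀ {n x y} → AgreeBelow n x y → x n ≡ y n → AgreeBelow (suc n) x y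
agreeBelow-suc {n} agree xn≡yn j j<1+n with m≤n⇒m<n∨m≡n (≤-pred j<1+n)
... | inj₁ j<n  = agree j j<n
... | inj₂ refl = xn≡yn

pre-! : ∀ x {n j} → j < n → pre x n ! j ≡ x j
pre-! x {suc n} {zero}  _         = refl
pre-! x {suc n} {suc j} (s≤s j<n) = pre-! (λ i → x (suc i)) j<n

pre≡⇒agree : ∀ {x w} → pre x (length w) ≡ w → AgreeBelow (length w) x (w !_)
pre≡⇒agree {x} {w} pre≡w j j<w = trans (sym (pre-! x j<w)) (cong (λ v → v ! j) pre≡w)

agree⇒pre≡ : ∀ {x} w → AgreeBelow (length w) x (w !_) → pre x (length w) ≡ w
agree⇒pre≡ []      _     = refl
agree⇒pre≡ (a ∷ w) agree =
  cong₂ _∷_ (agree 0 z<s) (agree⇒pre≡ w (λ j j<w → agree (suc j) (s≤s j<w)))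

first-half< : ∀ i k {j} → j < k → i + j < i + (k + k)
first-half< i k j<k = +-monoʳ-< i (<-≤-trans j<k (m≤m+n k k))

second-half< : ∀ i k {j} → j < k → i + k + j < i + (k + k)
second-half< i k {j} j<k = subst (_< i + (k + k)) (sym (+-assoc i k j)) (+-monoʳ-< i (+-monoʳ-< k j<k))

squareAt-transfer : ∀ {x y i k} → AgreeBelow (i + (k + k)) x y → SquareAt x i k → SquareAt y i k
squareAt-transfer {i = i} {k} agree (0<k , sq) = 0<k , λ j j<k →
  trans (sym (agree _ (first-half< i k j<k))) (trans (sq j j<k) (agree _ (second-half< i k j<k)))

squareAt-shift : ∀ {x n i k} → SquareAt x (n + i) k → SquareAt (λ j → x (n + j)) i k
squareAt-shift {x} {n} {i} {k} (0<k , sq) = 0<k , λ j j<k →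
  subst₂ (λ a b → x a ≡ x b) (+-assoc n i j) (trans (cong (_+ j) (+-assoc n i k)) (+-assoc n (i + k) j)) (sq j j<k)

square-≡ : ∀ {x i k j} → SquareAt x i k → i ≤ j → j + k < i + (k + k) → x j ≡ x (j + k)
square-≡ {x} {i} {k} (_ , sq) i≤j j+k<end with m≤n⇒∃[o]m+o≡n i≤j
... | o , refl = trans (sq o o<k) (cong x (swap i k o))
  where
  swap : ∀ i k o → i + k + o ≡ i + o + k
  swap = solve-∀
  o<k : o < k
  o<k = +-cancelˡ-< (i + k) o k (subst₂ _<_ (swap i o k) (sym (+-assoc i k k)) j+k<end)

SquaresEndBy : ℕ → InfWord → Set
SquaresEndBy n x = ∀ i k → SquareAt x i k → i + (k + k) ≤ n

SquaresWithin : Word → ℕ → Set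
SquaresWithin w n = ∀ i k → SquareAt (w !_) i k → i + (k + k) ≤ length w → i + (k + k) ≤ n

SquareFree : Word → Set
SquareFree w = ∀ i k → SquareAt (w !_) i k → ¬ i + (k + k) ≤ length w

SquareSuffix : Word → Set
SquareSuffix w = Σ Word λ z → Σ Word λ y → 0 < length y × w ≡ z ++ y ++ y

squareSuffix-++ˡ : ∀ v {w} → SquareSuffix w → SquareSuffix (v ++ w)
squareSuffix-++ˡ v (z , y , 0<y , refl) = v ++ z , y , 0<y , sym (++-assoc v z (y ++ y))

squareSuffix-bound : ∀ {x n} w → SquareSuffix w → AgreeBelow (length w) x (w !_) →
                     SquaresEndBy n x → length w ≤ n
squareSuffix-bound {x} _ (z , y , 0<y , refl) agree squares =
  subst (_≤ _) (sym length-zyy) (squares (length z) (length y) (0<y , halves-equal))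
  where
  length-zyy : length (z ++ y ++ y) ≡ length z + (length y + length y)
  length-zyy = trans (length-++ z) (cong (length z +_) (length-++ y))
  inside : ∀ {m} → m < length z + (length y + length y) → m < length (z ++ y ++ y)
  inside = subst (_ <_) (sym length-zyy)
  halves-equal : ∀ j → j < length y → x (length z + j) ≡ x (length z + length y + j)
  halves-equal j j<y = begin
    x (length z + j)                             ≡⟨ agree _ (inside (first-half< (length z) (length y) j<y)) ⟩
    (z ++ y ++ y) ! (length z + j)               ≡⟨ !-++ʳ z j ⟩
    (y ++ y) ! j                                 ≡⟨ !-++ˡ y j<y ⟩
    y ! j                                        ≡⟨ sym (!-++ʳ y j) ⟩
    (y ++ y) ! (length y + j)                    ≡⟨ sym (!-++ʳ z (length y + j)) ⟩
    (z ++ y ++ y) ! (length z + (length y + j))  ≡⟨ cong ((z ++ y ++ y) !_) (sym (+-assoc (length z) (length y) j)) ⟩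
    (z ++ y ++ y) ! (length z + length y + j)    ≡⟨ sym (agree _ (inside (second-half< (length z) (length y) j<y))) ⟩
    x (length z + length y + j)                  ∎
    where open ≡-Reasoning

GreedyFrom : ℕ → Word → Set
GreedyFrom n q = ∀ e a → n ≤ e → e < length q → a < q ! e → SquareSuffix (take e q ++ a ∷ [])

-- Greedy extensions generate

fresh : Word → InfWord
fresh w j with j <? length w
... | yes _ = w ! j
... | no  _ = suc (max 0 w) + j

fresh-agree : ∀ w → AgreeBelow (length w) (fresh w) (w !_)
fresh-agree w j j<w with j <? length w
... | yes _   = refl
... | no  j≮w = ⊥-elim (j≮w j<w)

fresh-beyond : ∀ w {j} → length w ≤ j → fresh w j ≡ suc (max 0 w) + j
fresh-beyond w {j} w≤j with j <? length w
... | yes j<w = ⊥-elim (<-irrefl refl (<-≤-trans j<w w≤j))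
... | no  _   = refl

fresh-squares : ∀ w → SquaresEndBy (length w) (fresh w)
fresh-squares w i (suc k) (_ , sq) with i + (suc k + suc k) ≤? length w
... | yes inside = inside
... | no  beyond = ⊥-elim (last-letters-differ (sq k ≤-refl))
  where
  M : ℕ
  M = suc (max 0 w)
  last : ℕ
  last = i + suc k + k
  end≡ : i + (suc k + suc k) ≡ suc last
  end≡ = trans (cong (i +_) (+-suc (suc k) k)) (trans (+-suc i (suc k + k)) (cong suc (sym (+-assoc i (suc k) k))))
  w≤last : length w ≤ last
  w≤last = ≤-pred (subst (length w <_) end≡ (≰⇒> beyond))
  last-letters-differ : fresh w (i + k) ≢ fresh w last
  last-letters-differ eq with length w ≤? i + k
  ... | no  i+k≮w = <-irrefl refl (begin-strict
      fresh w (i + k)  ≡⟨ fresh-agree w _ (≰⇒> i+k≮w) ⟩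
      w ! (i + k)      ≤⟨ All-! (xs≤max 0 w) (≰⇒> i+k≮w) ⟩
      max 0 w          <⟨ ≤-refl ⟩
      M                ≤⟨ m≤m+n M last ⟩
      M + last         ≡⟨ sym (fresh-beyond w w≤last) ⟩
      fresh w last     ≡⟨ sym eq ⟩
      fresh w (i + k)  ∎)
    where open ≤-Reasoning
  ... | yes w≤i+k = m≢1+n+m (i + k) {k} (begin
      i + k            ≡⟨ +-cancelˡ-≡ M _ _ (trans (sym (fresh-beyond w w≤i+k)) (trans eq (fresh-beyond w w≤last))) ⟩
      i + suc k + k    ≡⟨ cong (_+ k) (+-suc i k) ⟩
      suc (i + k + k)  ≡⟨ cong suc (+-comm (i + k) k) ⟩
      suc (k + (i + k)) ∎)
    where open ≡-Reasoning

fresh-take-agree : ∀ {m} w → m ≤ length w → AgreeBelow m (fresh (take m w)) (w !_)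
fresh-take-agree {m} w m≤w j j<m = begin
  fresh (take m w) j  ≡⟨ fresh-agree (take m w) j (subst (j <_) (sym (length-take-≤ w m≤w)) j<m) ⟩
  take m w ! j        ≡⟨ !-take m w j<m ⟩
  w ! j               ∎
  where open ≡-Reasoning

module GreedyExtension (p s : Word)
  (within : SquaresWithin (p ++ s) (length p))
  (greedy : GreedyFrom (length p) (p ++ s)) where

  q : Word
  q = p ++ s
  P : ℕ
  P = length p
  Q : ℕ
  Q = length q

  P≤Q : P ≤ Q
  P≤Q = subst (P ≤_) (sym (length-++ p)) (m≤m+n P (length s))

  q-extends-p : AgreeBelow P (q !_) (p !_)
  q-extends-p j j<P = !-++ˡ p j<P

  admissible-shorten : ∀ {y} → Admissible q y → Admissible p y
  admissible-shorten {y} (pre≡q , squares) =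
    agree⇒pre≡ p (λ j j<P → trans (y≈q j (<-≤-trans j<P P≤Q)) (q-extends-p j j<P)) ,
    λ i k sq → within i k (squareAt-transfer (agreeBelow-mono (squares i k sq) y≈q) sq) (squares i k sq)
    where
    y≈q : AgreeBelow Q y (q !_)
    y≈q = pre≡⇒agree pre≡q

  admissible-lengthen : ∀ {y} → Admissible p y → AgreeBelow Q y (q !_) → Admissible q y
  admissible-lengthen (_ , squares) y≈q =
    agree⇒pre≡ q y≈q , λ i k sq → ≤-trans (squares i k sq) P≤Q

  undercut-inadmissible : ∀ {y e} → P ≤ e → e < Q → AgreeBelow e y (q !_) → y e < q ! e →
                          ¬ SquaresEndBy P y
  undercut-inadmissible {y} {e} P≤e e<Q y≈q ye<qe squares = <-irrefl refl (begin-strict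
    suc e     ≡⟨ sym length-w ⟩
    length w  ≤⟨ squareSuffix-bound w (greedy e (y e) P≤e e<Q ye<qe) y≈w squares ⟩
    P         ≤⟨ P≤e ⟩
    e         <⟨ ≤-refl ⟩
    suc e     ∎)
    where
    open ≤-Reasoning
    w : Word
    w = take e q ++ y e ∷ []
    length-take-e : length (take e q) ≡ e
    length-take-e = length-take-≤ q (<⇒≤ e<Q)
    length-w : length w ≡ suc e
    length-w = trans (length-++ (take e q)) (trans (cong (_+ 1) length-take-e) (+-comm e 1))
    y≈w : AgreeBelow (length w) y (w !_)
    y≈w = subst (λ n → AgreeBelow n y (w !_)) (sym length-w) (agreeBelow-suc
      (λ j j<e → trans (y≈q j j<e) (sym (trans (!-++ˡ (take e q) (subst (j <_) (sym length-take-e) j<e)) (!-take e q j<e))))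
      (sym (subst (λ n → w ! n ≡ y e) length-take-e (!-++-∷ (take e q)))))

  fresh-admissible : ∀ {m} → P ≤ m → m < Q → Admissible p (fresh (take (suc m) q))
  fresh-admissible {m} P≤m m<Q =
    agree⇒pre≡ p (λ j j<P → trans (x≈q j (<-≤-trans j<P (m≤n⇒m≤1+n P≤m))) (q-extends-p j j<P)) ,
    λ i k sq → within i k (squareAt-transfer (agreeBelow-mono (end≤ i k sq) x≈q) sq)
                          (≤-trans (end≤ i k sq) m<Q)
    where
    x≈q : AgreeBelow (suc m) (fresh (take (suc m) q)) (q !_)
    x≈q = fresh-take-agree q m<Q
    end≤ : SquaresEndBy (suc m) (fresh (take (suc m) q))
    end≤ = subst (λ n → SquaresEndBy n (fresh (take (suc m) q))) (length-take-≤ q m<Q) (fresh-squares (take (suc m) q))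

  -- Position by position: a letter below q's completes a square, and one above it is undercut by
  -- the fresh continuation of q, which is admissible for p.
  least-agrees : ∀ {x} → IsL p x → AgreeBelow Q x (q !_)
  least-agrees {x} ((pre≡p , squares) , least) = agree-upto Q ≤-refl
    where
    agree-upto : ∀ n → n ≤ Q → AgreeBelow n x (q !_)
    agree-upto zero    _     j ()
    agree-upto (suc n) 1+n≤Q = agreeBelow-suc x≈q next
      where
      x≈q : AgreeBelow n x (q !_)
      x≈q = agree-upto n (<⇒≤ 1+n≤Q)
      next : x n ≡ q ! n
      next with n <? P
      ... | yes n<P = trans (pre≡⇒agree pre≡p n n<P) (sym (q-extends-p n n<P))
      ... | no  n≮P with <-cmp (x n) (q ! n)
      ...   | tri≈ _ xn≡qn _ = xn≡qn
      ...   | tri< xn<qn _ _ = ⊥-elim (undercut-inadmissible (≮⇒≥ n≮P) 1+n≤Q x≈q xn<qn squares)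
      ...   | tri> _ _ qn<xn = ⊥-elim (least y (fresh-admissible (≮⇒≥ n≮P) 1+n≤Q) (n , y≈x , y<x))
        where
        y : InfWord
        y = fresh (take (suc n) q)
        y≈q : AgreeBelow (suc n) y (q !_)
        y≈q = fresh-take-agree q 1+n≤Q
        y≈x : ∀ j → j < n → y j ≡ x j
        y≈x j j<n = trans (y≈q j (m<n⇒m<1+n j<n)) (sym (x≈q j j<n))
        y<x : y n < x n
        y<x = subst (_< x n) (sym (y≈q n ≤-refl)) qn<xn

  least-lengthens : ∀ {x} → IsL p x → IsL q x
  least-lengthens L@(admissible , least) =
    admissible-lengthen admissible (least-agrees L) ,
    λ y admissible-y → least y (admissible-shorten admissible-y)

  least-shortens : ∀ {x} → IsL q x → IsL p x
  least-shortens {x} (admissible , least) = admissible-shorten admissible , least′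
    where
    x≈q : AgreeBelow Q x (q !_)
    x≈q = pre≡⇒agree (proj₁ admissible)
    least′ : ∀ y → Admissible p y → ¬ y ≺ x
    least′ y (pre≡p , squares) (i , y≈x , yi<xi) with i <? Q
    ... | no  i≮Q = least y (admissible-lengthen (pre≡p , squares) y≈q) (i , y≈x , yi<xi)
      where
      y≈q : AgreeBelow Q y (q !_)
      y≈q j j<Q = trans (y≈x j (<-≤-trans j<Q (≮⇒≥ i≮Q))) (x≈q j j<Q)
    ... | yes i<Q with i <? P
    ...   | yes i<P = <-irrefl (trans (pre≡⇒agree pre≡p i i<P) (sym (trans (x≈q i i<Q) (q-extends-p i i<P)))) yi<xi
    ...   | no  i≮P = undercut-inadmissible (≮⇒≥ i≮P) i<Q
                        (λ j j<i → trans (y≈x j j<i) (x≈q j (<-trans j<i i<Q)))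
                        (subst (y i <_) (x≈q i i<Q) yi<xi) squares

  generates : Generates p q
  generates x = mk⇔ least-lengthens least-shortens

greedy-extension-generates : ∀ p s → SquaresWithin (p ++ s) (length p) → GreedyFrom (length p) (p ++ s) →
                             Generates p (p ++ s)
greedy-extension-generates = GreedyExtension.generates

-- Squares straddling the end of a prefix

straddle-partner : ∀ {x i k P} → SquareAt x i k → i + k < P → P ≤ i + (k + k) →
                   Σ ℕ λ z → i ≤ z × z + suc k ≡ P × x z ≡ x (z + k)
straddle-partner {x} {i} {k} square i+k<P P≤end with m≤n⇒∃[o]m+o≡n i+k<P
... | o , refl = i + o , m≤m+n i o , end-partner i o k ,
                 square-≡ {x} {i} {k} square (m≤m+n i o) (subst (_≤ i + (k + k)) (sym (after-partner i o k)) P≤end)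
  where
  end-partner : ∀ i o k → i + o + suc k ≡ suc (i + k) + o
  end-partner = solve-∀
  after-partner : ∀ i o k → suc (i + o + k) ≡ suc (i + k) + o
  after-partner = solve-∀

straddle-marker : ∀ {N p′ i k} p a → p ≡ p′ ++ N ∷ [] → SquareAt ((p ++ a) !_) i k →
                  i + k < length p → length p < i + (k + k) →
                  Σ ℕ λ z → i ≤ z × z + suc k ≡ length p × (p ++ a) ! z ≡ N
straddle-marker {N} {p′} {i} {k} p a refl square i+k<P P<end
  with straddle-partner square i+k<P (<⇒≤ P<end)
... | z , i≤z , z+1+k≡P , qz≡qz+k = z , i≤z , z+1+k≡P , (begin
  q ! z          ≡⟨ qz≡qz+k ⟩
  q ! (z + k)    ≡⟨ cong (q !_) (suc-injective (trans (sym (+-suc z k)) (trans z+1+k≡P (length-∷ʳ p′)))) ⟩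
  q ! length p′  ≡⟨ !-∷ʳ-++ p′ ⟩
  N              ∎)
  where
  open ≡-Reasoning
  q : Word
  q = p ++ a

NoStraddlingSquare : Word → ℕ → Set
NoStraddlingSquare q P = ∀ i k → SquareAt (q !_) i k → i + k < P → P < i + (k + k) → i + (k + k) ≤ length q → ⊥

-- A square ending after p lies inside a, or repeats the final N of p inside a, or straddles.
squaresWithin-from-marker : ∀ {N p′} p a → p ≡ p′ ++ N ∷ [] → All (_< N) a → SquareFree a →
                            NoStraddlingSquare (p ++ a) (length p) → SquaresWithin (p ++ a) (length p)
squaresWithin-from-marker p a refl a<N a-free no-straddle i zero (() , _) end≤q
squaresWithin-from-marker {N} {p′} p a refl a<N a-free no-straddle i (suc k) square end≤q
  with i + (suc k + suc k) ≤? length p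
... | yes end≤P = end≤P
... | no  end≰P with length p ≤? i
...   | yes P≤i = ⊥-elim (inside-a P≤i)
  where
  inside-a : length p ≤ i → ⊥
  inside-a P≤i with m≤n⇒∃[o]m+o≡n P≤i
  ... | i′ , refl = a-free i′ (suc k)
    (squareAt-transfer {y = a !_} (λ j _ → !-++ʳ p {a} j) (squareAt-shift {(p ++ a) !_} {length p} square))
    (+-cancelˡ-≤ (length p) _ _ (subst₂ _≤_ (+-assoc (length p) i′ (suc k + suc k)) (length-++ p) end≤q))
...   | no  P≰i with length p ≤? i + suc k
...     | no  P≰i+k = ⊥-elim (no-straddle i (suc k) square (≰⇒> P≰i+k) (≰⇒> end≰P) end≤q)
...     | yes P≤i+k = ⊥-elim (last-letter-repeated (m≤n⇒∃[o]m+o≡n (≤-pred (subst (i <_) (length-∷ʳ p′) (≰⇒> P≰i)))))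
  where
  q : Word
  q = p ++ a
  last-letter-repeated : Σ ℕ (λ o → i + o ≡ length p′) → ⊥
  last-letter-repeated (o , i+o≡) = <-irrefl (sym N≡) (All-! a<N k<a)
    where
    partner : i + suc k + o ≡ length p + k
    partner = trans (swap i (suc k) o)
                (trans (cong (_+ suc k) i+o≡) (trans (+-suc (length p′) k) (cong (_+ k) (sym (length-∷ʳ p′)))))
      where
      swap : ∀ i k o → i + k + o ≡ i + o + k
      swap = solve-∀
    o<k : o < suc k
    o<k = +-cancelˡ-< i o (suc k) (subst (_< i + suc k) (sym i+o≡)
            (<-≤-trans (subst (length p′ <_) (sym (length-∷ʳ p′)) ≤-refl) P≤i+k))
    k<a : k < length a
    k<a = +-cancelˡ-< (length p) k (length a) (begin-strict
      length p + k                 ≡⟨ sym partner ⟩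
      i + suc k + o                <⟨ +-monoʳ-< (i + suc k) o<k ⟩
      i + suc k + suc k            ≡⟨ +-assoc i (suc k) (suc k) ⟩
      i + (suc k + suc k)          ≤⟨ end≤q ⟩
      length q                     ≡⟨ length-++ p ⟩
      length p + length a          ∎)
      where open ≤-Reasoning
    N≡ : N ≡ a ! k
    N≡ = begin
      N                         ≡⟨ sym (!-∷ʳ-++ p′) ⟩
      q ! length p′             ≡⟨ cong (q !_) (sym i+o≡) ⟩
      q ! (i + o)               ≡⟨ proj₂ square o o<k ⟩
      q ! (i + suc k + o)       ≡⟨ cong (q !_) partner ⟩
      q ! (length p + k)        ≡⟨ !-++ʳ p k ⟩
      a ! k                     ∎
      where open ≡-Reasoning

straddle-agreement : ∀ {x i k z P} → SquareAt x i k → i ≤ z → z + suc k ≡ P → P < i + (k + k) →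
  Σ ℕ λ t → Σ ℕ λ n → P + t ≡ i + (k + k) × i + n ≡ z × n + suc t ≡ k
                      × (∀ r → r < t → x (z + suc r) ≡ x (P + r))
                      × (∀ j → z ≤ j + n → j < z → x j ≡ x (j + k))
straddle-agreement {x} {i} {k} {z} {P} square i≤z z+1+k≡P P<end
  with m≤n⇒∃[o]m+o≡n (<⇒≤ P<end) | m≤n⇒∃[o]m+o≡n i≤z
... | t , P+t≡end | n , i+n≡z = t , n , P+t≡end , i+n≡z , k≡ , after , before
  where
  k≡ : n + suc t ≡ k
  k≡ = +-cancelʳ-≡ k (n + suc t) k (+-cancelˡ-≡ i _ _ (begin
    i + (n + suc t + k)   ≡⟨ regroup i n t k ⟩
    i + n + suc k + t     ≡⟨ cong (λ m → m + suc k + t) i+n≡z ⟩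
    z + suc k + t         ≡⟨ cong (_+ t) z+1+k≡P ⟩
    P + t                 ≡⟨ P+t≡end ⟩
    i + (k + k)           ∎))
    where
    open ≡-Reasoning
    regroup : ∀ i n t k → i + (n + suc t + k) ≡ i + n + suc k + t
    regroup = solve-∀
  after-P : ∀ r → z + suc r + k ≡ P + r
  after-P r = trans (shift z r k) (cong (_+ r) z+1+k≡P)
    where
    shift : ∀ z r k → z + suc r + k ≡ z + suc k + r
    shift = solve-∀
  after : ∀ r → r < t → x (z + suc r) ≡ x (P + r)
  after r r<t = trans (square-≡ {x} square (≤-trans i≤z (m≤m+n z (suc r))) inside) (cong x (after-P r))
    where
    inside : z + suc r + k < i + (k + k)
    inside = subst (_< i + (k + k)) (sym (after-P r)) (subst (P + r <_) P+t≡end (+-monoʳ-< P r<t))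
  before : ∀ j → z ≤ j + n → j < z → x j ≡ x (j + k)
  before j z≤j+n j<z = square-≡ {x} square i≤j (begin-strict
    j + k          <⟨ +-monoˡ-< k j<z ⟩
    z + k          <⟨ subst (z + k <_) (trans (sym (+-suc z k)) z+1+k≡P) ≤-refl ⟩
    P              <⟨ P<end ⟩
    i + (k + k)    ∎)
    where
    open ≤-Reasoning
    i≤j : i ≤ j
    i≤j = +-cancelʳ-≤ n i j (subst (_≤ j + n) (sym i+n≡z) z≤j+n)

straddle-refute : ∀ {x i k z P} → SquareAt x i k → i ≤ z → z + suc k ≡ P → P < i + (k + k) →
                  ∀ c → x (z + suc c) ≢ x (P + c) →
                  ∀ j b → j + suc b ≡ z → c + b + 2 ≤ k → x j ≢ x (j + k) → ⊥
straddle-refute {x} {i} {k} square i≤z z+1+k≡P P<end c after≢ j b j+1+b≡z room before≢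
  with straddle-agreement {x} square i≤z z+1+k≡P P<end
... | t , n , _ , _ , k≡ , after , before = <-irrefl refl (begin-strict
  k          ≡⟨ sym k≡ ⟩
  n + suc t  ≤⟨ +-mono-≤ n≤b (s≤s t≤c) ⟩
  b + suc c  ≡⟨ regroup b c ⟩
  c + b + 1  <⟨ +-monoʳ-< (c + b) ≤-refl ⟩
  c + b + 2  ≤⟨ room ⟩
  k          ∎)
  where
  open ≤-Reasoning
  regroup : ∀ b c → b + suc c ≡ c + b + 1
  regroup = solve-∀
  t≤c : t ≤ c
  t≤c = ≮⇒≥ λ c<t → after≢ (after c c<t)
  n≤b : n ≤ b
  n≤b = ≮⇒≥ λ b<n → before≢ (before j (subst (_≤ j + n) j+1+b≡z (+-monoʳ-≤ j b<n))
                                       (subst (j <_) j+1+b≡z (m<m+n j z<s)))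

marker-split : ∀ {N} s r z → All (_< N) s → (s ++ N ∷ r) ! z ≡ N →
               z ≡ length s ⊎ Σ ℕ λ z′ → z ≡ length s + suc z′ × r ! z′ ≡ N
marker-split []      r zero    _          _  = inj₁ refl
marker-split []      r (suc z) _          e  = inj₂ (z , refl , e)
marker-split (a ∷ s) r zero    (a<N ∷ _)  a≡N = ⊥-elim (<-irrefl a≡N a<N)
marker-split (a ∷ s) r (suc z) (_ ∷ s<N) e with marker-split s r z s<N e
... | inj₁ z≡             = inj₁ (cong suc z≡)
... | inj₂ (z′ , z≡ , e′) = inj₂ (z′ , cong suc z≡ , e′)

-- Checks by evaluation

T-not : ∀ {b} → T (not b) → ¬ T b
T-not t = subst T (to T-not-≡ t)

prefixEqᵇ : ℕ → Word → Word → Bool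
prefixEqᵇ zero    _       _       = true
prefixEqᵇ (suc k) (a ∷ u) (b ∷ v) = (a ≡ᵇ b) ∧ prefixEqᵇ k u v
prefixEqᵇ (suc k) _       _       = false

prefixEqᵇ-sound : ∀ k u v → T (prefixEqᵇ k u v) → take k u ≡ take k v × k ≤ length v
prefixEqᵇ-sound zero    u       v       _ = refl , z≤n
prefixEqᵇ-sound (suc k) (a ∷ u) (b ∷ v) t with to T-∧ t
... | a≡b , rest with prefixEqᵇ-sound k u v rest
...   | u≈v , k≤v = cong₂ _∷_ (≡ᵇ⇒≡ a b a≡b) u≈v , s≤s k≤v

prefixEqᵇ-complete : ∀ k u v → k ≤ length u → k ≤ length v → (∀ j → j < k → u ! j ≡ v ! j) →
                     T (prefixEqᵇ k u v)
prefixEqᵇ-complete zero    u       v       _         _         _    = _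
prefixEqᵇ-complete (suc k) (a ∷ u) (b ∷ v) (s≤s k≤u) (s≤s k≤v) same =
  from T-∧ (≡⇒≡ᵇ a b (same 0 z<s) , prefixEqᵇ-complete k u v k≤u k≤v (λ j j<k → same (suc j) (s≤s j<k)))

allBelowᵇ : ℕ → (ℕ → Bool) → Bool
allBelowᵇ zero    f = true
allBelowᵇ (suc n) f = f n ∧ allBelowᵇ n f

allBelowᵇ-sound : ∀ n f → T (allBelowᵇ n f) → ∀ a → a < n → T (f a)
allBelowᵇ-sound (suc n) f t a a<1+n with to T-∧ t | m≤n⇒m<n∨m≡n (≤-pred a<1+n)
... | _ , rest | inj₁ a<n  = allBelowᵇ-sound n f rest a a<n
... | fn , _   | inj₂ refl = fn

-- f t r b w is checked at each position t, with b the letter there, r the reversed prefix before it and w the rest.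
allPositionsᵇ : (ℕ → Word → ℕ → Word → Bool) → ℕ → Word → Word → Bool
allPositionsᵇ f t r []      = true
allPositionsᵇ f t r (b ∷ w) = f t r b w ∧ allPositionsᵇ f (suc t) (b ∷ r) w

allPositionsᵇ-sound : ∀ f c r w → T (allPositionsᵇ f c r w) →
                      ∀ t → t < length w → T (f (t + c) (take t w ʳ++ r) (w ! t) (drop (suc t) w))
allPositionsᵇ-sound f c r (b ∷ w) all zero    _ = proj₁ (to T-∧ all)
allPositionsᵇ-sound f c r (b ∷ w) all (suc t) (s≤s t<w) =
  subst (λ n → T (f n (take t w ʳ++ b ∷ r) (w ! t) (drop (suc t) w))) (+-suc t c)
    (allPositionsᵇ-sound f (suc c) (b ∷ r) w (proj₂ (to T-∧ all)) t t<w)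

-- No square of half-length k starts at the first c positions of s, where s′ is the suffix k letters after s.
noSquareRunᵇ : ℕ → ℕ → Word → Word → Bool
noSquareRunᵇ zero    c       s s′ = true
noSquareRunᵇ (suc k) zero    s s′ = true
noSquareRunᵇ (suc k) (suc c) s s′ = not (prefixEqᵇ (suc k) s s′) ∧ noSquareRunᵇ (suc k) c (drop 1 s) (drop 1 s′)

noSquareRunᵇ-sound : ∀ k c i w → T (noSquareRunᵇ k c (drop i w) (drop (i + k) w)) →
                     ∀ m → m < c → SquareAt (w !_) (m + i) k → ¬ (m + i) + (k + k) ≤ length w
noSquareRunᵇ-sound zero c i w t m m<c (() , _)
noSquareRunᵇ-sound k@(suc _) (suc c) i w t zero _ (_ , sq) end≤w =
  T-not (proj₁ (to T-∧ t)) (prefixEqᵇ-complete k (drop i w) (drop (i + k) w)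
    (fits i (≤-trans (≤-reflexive (+-comm k i)) (+-monoʳ-≤ i (m≤m+n k k))))
    (fits (i + k) (≤-reflexive (trans (+-comm k (i + k)) (+-assoc i k k))))
    (λ j j<k → trans (!-drop i w j) (trans (sq j j<k) (sym (!-drop (i + k) w j)))))
  where
  fits : ∀ n → k + n ≤ i + (k + k) → k ≤ length (drop n w)
  fits n k+n≤end = subst (k ≤_) (sym (length-drop n w)) (m+n≤o⇒m≤o∸n k (≤-trans k+n≤end end≤w))
noSquareRunᵇ-sound k@(suc _) (suc c) i w t (suc m) (s≤s m<c) square =
  subst (λ n → SquareAt (w !_) n k → ¬ n + (k + k) ≤ length w) (+-suc m i)
    (noSquareRunᵇ-sound k c (suc i) w
      (subst₂ (λ s s′ → T (noSquareRunᵇ k c s s′)) (drop-suc i w) (drop-suc (i + k) w) (proj₂ (to T-∧ t)))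
      m m<c)
    square

-- n is the length of w, passed as an argument so that evaluation computes it only once.
squareFreeWithinᵇ : ℕ → Word → Bool
squareFreeWithinᵇ n w = allBelowᵇ n λ k → noSquareRunᵇ (suc k) (suc (n ∸ (suc k + suc k))) w (drop (suc k) w)

squareFreeᵇ : Word → Bool
squareFreeᵇ w = squareFreeWithinᵇ (length w) w

squareFreeᵇ-sound : ∀ w → squareFreeᵇ w ≡ true → SquareFree w
squareFreeᵇ-sound w check i (suc k) square end≤w =
  noSquareRunᵇ-sound (suc k) _ 0 w (allBelowᵇ-sound (length w) _ (from T-≡ check) k k<w) i (s≤s (m+n≤o⇒m≤o∸n i end≤w))
    (subst (λ n → SquareAt (w !_) n (suc k)) (sym (+-identityʳ i)) square)
    (subst (λ n → n + (suc k + suc k) ≤ length w) (sym (+-identityʳ i)) end≤w)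
  where
  k<w : k < length w
  k<w = ≤-trans (m≤m+n (suc k) (suc k)) (≤-trans (m≤n+m (suc k + suc k) i) end≤w)

SquarePrefix : Word → Set
SquarePrefix w = Σ Word λ y → Σ Word λ z → 0 < length y × w ≡ y ++ y ++ z

-- d is the suffix of u after its first k letters.
squarePrefixFromᵇ : ℕ → Word → Word → Bool
squarePrefixFromᵇ k u []      = false
squarePrefixFromᵇ k u (b ∷ d) = prefixEqᵇ k u (b ∷ d) ∨ squarePrefixFromᵇ (suc k) u d

squarePrefixFromᵇ-sound : ∀ k u d → 0 < k → d ≡ drop k u → T (squarePrefixFromᵇ k u d) → SquarePrefix u
squarePrefixFromᵇ-sound k u (b ∷ d) 0<k d≡ t with to T-∨ t
... | inj₂ later = squarePrefixFromᵇ-sound (suc k) u d z<s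
                     (trans (cong (drop 1) d≡) (drop-suc k u)) later
... | inj₁ found with prefixEqᵇ-sound k u (b ∷ d) found
...   | same , k≤d = take k u , drop k (b ∷ d) , 0<y , u≡yyz
  where
  k≤u : k ≤ length u
  k≤u = ≤-trans k≤d (subst (_≤ length u) (sym (trans (cong length d≡) (length-drop k u))) (m∸n≤m (length u) k))
  0<y : 0 < length (take k u)
  0<y = subst (0 <_) (sym (length-take-≤ u k≤u)) 0<k
  u≡yyz : u ≡ take k u ++ take k u ++ drop k (b ∷ d)
  u≡yyz = begin
    u                                        ≡⟨ sym (take++drop≡id k u) ⟩
    take k u ++ drop k u                     ≡⟨ cong (take k u ++_) (sym d≡) ⟩
    take k u ++ b ∷ d                        ≡⟨ cong (take k u ++_) (sym (take++drop≡id k (b ∷ d))) ⟩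
    take k u ++ take k (b ∷ d) ++ drop k (b ∷ d) ≡⟨ cong (λ y → take k u ++ y ++ drop k (b ∷ d)) (sym same) ⟩
    take k u ++ take k u ++ drop k (b ∷ d)   ∎
    where open ≡-Reasoning

hasSquarePrefixᵇ : Word → Bool
hasSquarePrefixᵇ u = squarePrefixFromᵇ 1 u (drop 1 u)

hasSquarePrefixᵇ-sound : ∀ u → T (hasSquarePrefixᵇ u) → SquarePrefix u
hasSquarePrefixᵇ-sound u = squarePrefixFromᵇ-sound 1 u (drop 1 u) z<s refl

squarePrefix-reverse : ∀ w → SquarePrefix (reverse w) → SquareSuffix w
squarePrefix-reverse w (y , z , 0<y , w′≡) = reverse z , reverse y , subst (0 <_) (sym (length-reverse y)) 0<y , (begin
  w                                   ≡⟨ sym (reverse-involutive w) ⟩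
  reverse (reverse w)                 ≡⟨ cong reverse w′≡ ⟩
  reverse (y ++ y ++ z)               ≡⟨ reverse-++ y (y ++ z) ⟩
  reverse (y ++ z) ++ reverse y       ≡⟨ cong (_++ reverse y) (reverse-++ y z) ⟩
  (reverse z ++ reverse y) ++ reverse y ≡⟨ ++-assoc (reverse z) (reverse y) (reverse y) ⟩
  reverse z ++ reverse y ++ reverse y ∎)
  where open ≡-Reasoning

greedyAtᵇ : (ℕ → ℕ → Bool) → ℕ → Word → ℕ → Bool
greedyAtᵇ allowed t r b = allBelowᵇ b λ a → allowed t a ∨ hasSquarePrefixᵇ (a ∷ r)

-- A smaller letter a at position t with T (allowed t a) is exempt from the check.
greedyᵇ : (ℕ → ℕ → Bool) → Word → Bool
greedyᵇ allowed = allPositionsᵇ (λ t r b _ → greedyAtᵇ allowed t r b) 0 []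

greedyᵇ-sound : ∀ allowed w → greedyᵇ allowed w ≡ true → ∀ t a → t < length w → a < w ! t →
                T (allowed t a) ⊎ SquareSuffix (take t w ++ a ∷ [])
greedyᵇ-sound allowed w check t a t<w a<wt with to T-∨ (allBelowᵇ-sound (w ! t) _ at-t a a<wt)
  where
  at-t : T (greedyAtᵇ allowed t (take t w ʳ++ []) (w ! t))
  at-t = subst (λ n → T (greedyAtᵇ allowed n (take t w ʳ++ []) (w ! t))) (+-identityʳ t)
           (allPositionsᵇ-sound _ 0 [] w (from T-≡ check) t t<w)
... | inj₁ exempt = inj₁ exempt
... | inj₂ found  = inj₂ (squarePrefix-reverse (take t w ++ a ∷ [])
                      (subst SquarePrefix reversed (hasSquarePrefixᵇ-sound (a ∷ (take t w ʳ++ [])) found)))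
  where
  reversed : a ∷ (take t w ʳ++ []) ≡ reverse (take t w ++ a ∷ [])
  reversed = trans (cong (a ∷_) (trans (ʳ++-defn (take t w)) (++-identityʳ _))) (sym (reverse-++ (take t w) (a ∷ [])))

commonPrefixLength : Word → Word → ℕ
commonPrefixLength (a ∷ u) (b ∷ v) with a ≟ b
... | yes _ = suc (commonPrefixLength u v)
... | no  _ = 0
commonPrefixLength _ _ = 0

commonPrefixLength-≥ : ∀ {n} u v → n ≤ length u → n ≤ length v → (∀ r → r < n → u ! r ≡ v ! r) →
                       n ≤ commonPrefixLength u v
commonPrefixLength-≥ {zero}  u       v       _         _         _    = z≤n
commonPrefixLength-≥ {suc n} (a ∷ u) (b ∷ v) (s≤s n≤u) (s≤s n≤v) same with a ≟ b
... | yes _   = s≤s (commonPrefixLength-≥ u v n≤u n≤v (λ r r<n → same (suc r) (s≤s r<n)))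
... | no  a≢b = ⊥-elim (a≢b (same 0 z<s))

-- At each N of p′, k letters before its end, fewer than k - 1 letters agree after it (with a) and
-- before it (with the end of p′); by straddle-agreement this excludes straddling squares.
noStraddleAtᵇ : ℕ → Word → Word → ℕ → ℕ → Word → ℕ → Word → Bool
noStraddleAtᵇ N a rp′ len z r b rest =
  not (b ≡ᵇ N) ∨ (suc (commonPrefixLength (rest ++ N ∷ a) a + commonPrefixLength r rp′) <ᵇ len ∸ z)

noStraddleᵇ : ℕ → Word → Word → Bool
noStraddleᵇ N p′ a = allPositionsᵇ (noStraddleAtᵇ N a (reverse p′) (length p′)) 0 [] p′

match-after : ∀ {N} p′ a {z t} → z < length p′ → t ≤ length a →
              (∀ r → r < t → (p′ ++ N ∷ a) ! (suc z + r) ≡ a ! r) →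
              t ≤ commonPrefixLength (drop (suc z) p′ ++ N ∷ a) a
match-after {N} p′ a {z} {t} z<p′ t≤a agree = commonPrefixLength-≥ (drop (suc z) p′ ++ N ∷ a) a
  (≤-trans t≤a (subst (length a ≤_) (sym (length-++ (drop (suc z) p′)))
                 (≤-trans (n≤1+n _) (m≤n+m (suc (length a)) (length (drop (suc z) p′))))))
  t≤a
  (λ r r<t → begin
    (drop (suc z) p′ ++ N ∷ a) ! r  ≡⟨ cong (λ w → w ! r) (sym (drop-++ˡ p′ (N ∷ a) z<p′)) ⟩
    drop (suc z) (p′ ++ N ∷ a) ! r  ≡⟨ !-drop (suc z) (p′ ++ N ∷ a) r ⟩
    (p′ ++ N ∷ a) ! (suc z + r)     ≡⟨ agree r r<t ⟩
    a ! r                           ∎)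
  where open ≡-Reasoning

match-before : ∀ p′ {z k n} → z + k ≡ length p′ → n ≤ z →
               (∀ j → z ≤ j + n → j < z → p′ ! j ≡ p′ ! (j + k)) →
               n ≤ commonPrefixLength (reverse (take z p′)) (reverse p′)
match-before p′ {z} {k} {n} z+k≡ n≤z agree = commonPrefixLength-≥ (reverse (take z p′)) (reverse p′)
  (subst (n ≤_) (sym (trans (length-reverse (take z p′)) length-take-z)) n≤z)
  (subst (n ≤_) (sym (length-reverse p′)) (≤-trans n≤z (subst (z ≤_) z+k≡ (m≤m+n z k))))
  same
  where
  length-take-z : length (take z p′) ≡ z
  length-take-z = length-take-≤ p′ (subst (z ≤_) z+k≡ (m≤m+n z k))
  same : ∀ r → r < n → reverse (take z p′) ! r ≡ reverse p′ ! r
  same r r<n with m≤n⇒∃[o]m+o≡n (≤-trans r<n n≤z)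
  ... | j , 1+r+j≡z = begin
    reverse (take z p′) ! r  ≡⟨ !-reverse (take z p′) (trans r+1+j≡z (sym length-take-z)) ⟩
    take z p′ ! j            ≡⟨ !-take z p′ j<z ⟩
    p′ ! j                   ≡⟨ agree j z≤j+n j<z ⟩
    p′ ! (j + k)             ≡⟨ sym (!-reverse p′ partner) ⟩
    reverse p′ ! r           ∎
    where
    open ≡-Reasoning
    r+1+j≡z : r + suc j ≡ z
    r+1+j≡z = trans (+-suc r j) 1+r+j≡z
    j+1+r≡z : j + suc r ≡ z
    j+1+r≡z = trans (+-comm j (suc r)) 1+r+j≡z
    j<z : j < z
    j<z = subst (j <_) j+1+r≡z (m<m+n j z<s)
    z≤j+n : z ≤ j + n
    z≤j+n = subst (_≤ j + n) j+1+r≡z (+-monoʳ-≤ j r<n)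
    partner : r + suc (j + k) ≡ length p′
    partner = trans (regroup r j k) (trans (cong (_+ k) j+1+r≡z) z+k≡)
      where
      regroup : ∀ r j k → r + suc (j + k) ≡ j + suc r + k
      regroup = solve-∀

noStraddleᵇ-sound : ∀ {N} p′ {p} a → p ≡ p′ ++ N ∷ [] → noStraddleᵇ N p′ a ≡ true →
                    NoStraddlingSquare (p ++ a) (length p)
noStraddleᵇ-sound {N} p′ {p} a refl check i k square i+k<P P<end end≤q
  with straddle-marker p a refl square i+k<P P<end
... | z , i≤z , z+1+k≡P , qz≡N with straddle-agreement {(p ++ a) !_} square i≤z z+1+k≡P P<end
... | t , n , P+t≡end , i+n≡z , k≡ , after , before = <-irrefl refl (begin-strict
  k            ≡⟨ sym k≡ ⟩
  n + suc t    ≤⟨ +-mono-≤ n≤g (s≤s t≤f) ⟩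
  g + suc f    ≡⟨ trans (+-suc g f) (cong suc (+-comm g f)) ⟩
  suc (f + g)  <⟨ checked ⟩
  k            ∎)
  where
  open ≤-Reasoning
  q : Word
  q = p ++ a
  z+k≡ : z + k ≡ length p′
  z+k≡ = suc-injective (trans (sym (+-suc z k)) (trans z+1+k≡P (length-∷ʳ p′)))
  z<p′ : z < length p′
  z<p′ = subst (z <_) z+k≡ (m<m+n z (proj₁ square))
  in-p′ : ∀ {m} → m < length p′ → q ! m ≡ p′ ! m
  in-p′ m<p′ = trans (cong (λ w → w ! _) (∷ʳ-++ p′ N a)) (!-++ˡ p′ m<p′)
  f g : ℕ
  f = commonPrefixLength (drop (suc z) p′ ++ N ∷ a) a
  g = commonPrefixLength (reverse (take z p′)) (reverse p′)
  at-z : T (noStraddleAtᵇ N a (reverse p′) (length p′) z (reverse (take z p′)) N (drop (suc z) p′))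
  at-z = subst₂ (λ m b → T (noStraddleAtᵇ N a (reverse p′) (length p′) m (reverse (take z p′)) b (drop (suc z) p′)))
           (+-identityʳ z) (trans (sym (in-p′ z<p′)) qz≡N)
           (subst (λ r → T (noStraddleAtᵇ N a (reverse p′) (length p′) (z + 0) r (p′ ! z) (drop (suc z) p′)))
              (trans (ʳ++-defn (take z p′)) (++-identityʳ _)) (allPositionsᵇ-sound _ 0 [] p′ (from T-≡ check) z z<p′))
  checked : suc (f + g) < k
  checked with to T-∨ at-z
  ... | inj₁ N≢N  = ⊥-elim (T-not N≢N (≡⇒≡ᵇ N N refl))
  ... | inj₂ short = subst (suc (f + g) <_) (trans (cong (_∸ z) (sym z+k≡)) (m+n∸m≡n z k)) (<ᵇ⇒< _ _ short)
  t≤f : t ≤ f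
  t≤f = match-after p′ a z<p′ (+-cancelˡ-≤ (length p) t (length a) (subst₂ _≤_ (sym P+t≡end) (length-++ p) end≤q))
          λ r r<t → trans (cong (λ w → w ! (suc z + r)) (sym (∷ʳ-++ p′ N a)))
                      (trans (cong (q !_) (sym (+-suc z r))) (trans (after r r<t) (!-++ʳ p r)))
  n≤g : n ≤ g
  n≤g = match-before p′ z+k≡ (subst (n ≤_) i+n≡z (m≤n+m n i))
          λ j z≤j+n j<z → trans (sym (in-p′ (<-trans j<z z<p′)))
                            (trans (before j z≤j+n j<z) (in-p′ (subst (j + k <_) z+k≡ (+-monoˡ-< k j<z))))

-- Ruler words and the shape of α

∷ʳ-⁺ : ∀ (u : Word) a → (u ++ a ∷ []) ⁺ ≡ u ++ suc a ∷ []
∷ʳ-⁺ []          a = refl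
∷ʳ-⁺ (b ∷ [])    a = refl
∷ʳ-⁺ (b ∷ c ∷ u) a = cong (b ∷_) (∷ʳ-⁺ (c ∷ u) a)

Rinit : ℕ → Word
Rinit zero    = []
Rinit (suc n) = apply ρ (Rinit n) ++ 0 ∷ []

R-∷ʳ : ∀ n → R n ≡ Rinit n ++ n ∷ []
R-∷ʳ zero    = refl
R-∷ʳ (suc n) = begin
  apply ρ (R n)                              ≡⟨ cong (apply ρ) (R-∷ʳ n) ⟩
  apply ρ (Rinit n ++ n ∷ [])                ≡⟨ concatMap-++ ρ (Rinit n) (n ∷ []) ⟩
  apply ρ (Rinit n) ++ 0 ∷ suc n ∷ []        ≡⟨ sym (++-assoc (apply ρ (Rinit n)) (0 ∷ []) (suc n ∷ [])) ⟩
  (apply ρ (Rinit n) ++ 0 ∷ []) ++ suc n ∷ [] ∎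
  where open ≡-Reasoning

Rinit-suc : ∀ n → Rinit (suc n) ≡ R n ++ Rinit n
Rinit-suc zero    = refl
Rinit-suc (suc n) = begin
  apply ρ (Rinit (suc n)) ++ 0 ∷ []         ≡⟨ cong (λ w → apply ρ w ++ 0 ∷ []) (Rinit-suc n) ⟩
  apply ρ (R n ++ Rinit n) ++ 0 ∷ []        ≡⟨ cong (_++ 0 ∷ []) (concatMap-++ ρ (R n) (Rinit n)) ⟩
  (R (suc n) ++ apply ρ (Rinit n)) ++ 0 ∷ [] ≡⟨ ++-assoc (R (suc n)) (apply ρ (Rinit n)) (0 ∷ []) ⟩
  R (suc n) ++ Rinit (suc n)                ∎
  where open ≡-Reasoning

r₆ : Word
r₆ = 0 ∷ 1 ∷ 0 ∷ 2 ∷ 0 ∷ 1 ∷ []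

Cinit : Word
Cinit = 0 ∷ 1 ∷ 0 ∷ 2 ∷ 0 ∷ 3 ∷ 0 ∷ 1 ∷ 0 ∷ []

r₆-letters : All (_< 3) r₆
r₆-letters = toWitness {a? = All.all? (_<? 3) r₆} tt

C-letters : All (_< 4) C
C-letters = toWitness {a? = All.all? (_<? 4) C} tt

Rmid : ℕ → Word
Rmid zero    = 0 ∷ []
Rmid (suc j) = Rmid j ++ 3 + j ∷ r₆ ++ Rmid j

Rinit-Rmid : ∀ j → Rinit (3 + j) ≡ r₆ ++ Rmid j
Rinit-Rmid zero    = refl
Rinit-Rmid (suc j) = begin
  Rinit (4 + j)                                ≡⟨ Rinit-suc (3 + j) ⟩
  R (3 + j) ++ Rinit (3 + j)                   ≡⟨ cong (_++ Rinit (3 + j)) (R-∷ʳ (3 + j)) ⟩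
  (Rinit (3 + j) ++ 3 + j ∷ []) ++ Rinit (3 + j) ≡⟨ ++-assoc (Rinit (3 + j)) (3 + j ∷ []) (Rinit (3 + j)) ⟩
  Rinit (3 + j) ++ 3 + j ∷ Rinit (3 + j)       ≡⟨ cong (λ w → w ++ 3 + j ∷ w) (Rinit-Rmid j) ⟩
  (r₆ ++ Rmid j) ++ 3 + j ∷ r₆ ++ Rmid j       ≡⟨ ++-assoc r₆ (Rmid j) (3 + j ∷ r₆ ++ Rmid j) ⟩
  r₆ ++ Rmid (suc j)                           ∎
  where open ≡-Reasoning

R-Rmid : ∀ j → R (3 + j) ≡ r₆ ++ Rmid j ++ 3 + j ∷ []
R-Rmid j = trans (R-∷ʳ (3 + j)) (trans (cong (_++ 3 + j ∷ []) (Rinit-Rmid j)) (++-assoc r₆ (Rmid j) (3 + j ∷ [])))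

Rmid-letters : ∀ j → All (_< 3 + j) (Rmid j)
Rmid-letters zero    = s≤s z≤n ∷ []
Rmid-letters (suc j) = ++⁺ (All.map m<n⇒m<1+n (Rmid-letters j))
  (≤-refl ∷ ++⁺ (All.map (λ a<3 → ≤-trans a<3 (m≤m+n 3 (suc j))) r₆-letters) (All.map m<n⇒m<1+n (Rmid-letters j)))

block : ℕ → Word → Word → Word
block N D u = u ++ 2 ∷ D ++ N ∷ []

ruler : ℕ → Word → Word
ruler N D = r₆ ++ D ++ N ∷ []

shape : ℕ → Word → Word → Word
shape N D u = block N D u ++ ruler N D ++ C ++ block N D u ++ ruler N D

shapeInit : ℕ → Word → Word → Word
shapeInit N D u = block N D u ++ ruler N D ++ C ++ block N D u ++ r₆ ++ D

shape-∷ʳ : ∀ N D u → shape N D u ≡ shapeInit N D u ++ N ∷ []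
shape-∷ʳ N D u = ++-solve 6 (λ u d r c two n →
    (u ⊕ two ⊕ d ⊕ n) ⊕ (r ⊕ d ⊕ n) ⊕ c ⊕ (u ⊕ two ⊕ d ⊕ n) ⊕ (r ⊕ d ⊕ n)
  ⊜ ((u ⊕ two ⊕ d ⊕ n) ⊕ (r ⊕ d ⊕ n) ⊕ c ⊕ (u ⊕ two ⊕ d ⊕ n) ⊕ r ⊕ d) ⊕ n)
  refl u D r₆ C (2 ∷ []) (N ∷ [])

shape-ends : ∀ w N D u → w ++ shape N D u ≡ (w ++ shapeInit N D u) ++ N ∷ []
shape-ends w N D u = trans (cong (w ++_) (shape-∷ʳ N D u)) (sym (++-assoc w (shapeInit N D u) (N ∷ [])))

shape-⁺ : ∀ N D u → shape N D u ⁺ ≡ block (suc N) (D ++ N ∷ r₆ ++ D) (block N D u ++ ruler N D ++ C ++ u)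
shape-⁺ N D u = begin
  shape N D u ⁺                                                         ≡⟨ cong _⁺ (shape-∷ʳ N D u) ⟩
  (shapeInit N D u ++ N ∷ []) ⁺                                          ≡⟨ ∷ʳ-⁺ (shapeInit N D u) N ⟩
  shapeInit N D u ++ suc N ∷ []                                          ≡⟨ regroup ⟩
  block (suc N) (D ++ N ∷ r₆ ++ D) (block N D u ++ ruler N D ++ C ++ u)  ∎
  where
  open ≡-Reasoning
  regroup : shapeInit N D u ++ suc N ∷ [] ≡ block (suc N) (D ++ N ∷ r₆ ++ D) (block N D u ++ ruler N D ++ C ++ u)
  regroup = ++-solve 7 (λ u d r c two n sn →
      ((u ⊕ two ⊕ d ⊕ n) ⊕ (r ⊕ d ⊕ n) ⊕ c ⊕ (u ⊕ two ⊕ d ⊕ n) ⊕ r ⊕ d) ⊕ sn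
    ⊜ ((u ⊕ two ⊕ d ⊕ n) ⊕ (r ⊕ d ⊕ n) ⊕ c ⊕ u) ⊕ two ⊕ (d ⊕ n ⊕ r ⊕ d) ⊕ sn)
    refl u D r₆ C (2 ∷ []) (N ∷ []) (suc N ∷ [])

u₁ : Word
u₁ = take 1561 B₁

α₁-shape : α 1 ≡ shape 4 (Rmid 1) u₁
α₁-shape = refl

shape-letters : ∀ {N D u} → 3 ≤ N → All (_< N) D → All (_< N) u →
                All (_< suc N) (block N D u ++ ruler N D ++ C ++ u)
shape-letters {N} 3≤N D<N u<N =
  ++⁺ (++⁺ (weaken u<N) (2<1+N ∷ ++⁺ (weaken D<N) N<1+N))
      (++⁺ (++⁺ (All<-weaken (≤-trans 3≤N (n≤1+n N)) r₆-letters) (++⁺ (weaken D<N) N<1+N))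
           (++⁺ (All<-weaken (s≤s 3≤N) C-letters) (weaken u<N)))
  where
  weaken : ∀ {w} → All (_< N) w → All (_< suc N) w
  weaken = All<-weaken (n≤1+n N)
  2<1+N : 2 < suc N
  2<1+N = s≤s (≤-trans (s≤s (s≤s z≤n)) 3≤N)
  N<1+N : All (_< suc N) (N ∷ [])
  N<1+N = ≤-refl ∷ []

α-shape-step : ∀ m {u} → α (suc m) ⁺ ≡ block (5 + m) (Rmid (2 + m)) u → α (2 + m) ≡ shape (5 + m) (Rmid (2 + m)) u
α-shape-step m α⁺≡ = cong₂ (λ x r → x ++ r ++ C ++ x ++ r) α⁺≡ (trans (cong R (+-comm (2 + m) 3)) (R-Rmid (2 + m)))

α⁺-block : ∀ m → Σ Word λ u → α (suc m) ⁺ ≡ block (5 + m) (Rmid (2 + m)) u × All (_< 5 + m) u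
α⁺-block zero    = take 3159 (α 1 ⁺) , refl , toWitness {a? = all? (_<? 5) (take 3159 (α 1 ⁺))} tt
α⁺-block (suc m) with α⁺-block m
... | u , α⁺≡ , u<N = block (5 + m) (Rmid (2 + m)) u ++ ruler (5 + m) (Rmid (2 + m)) ++ C ++ u ,
                      trans (cong _⁺ (α-shape-step m α⁺≡)) (shape-⁺ (5 + m) (Rmid (2 + m)) u) ,
                      shape-letters (m≤m+n 3 (2 + m)) (Rmid-letters (2 + m)) u<N

α-shape : ∀ m → Σ Word λ u → α (2 + m) ≡ shape (5 + m) (Rmid (2 + m)) u × All (_< 5 + m) u
α-shape m with α⁺-block m
... | u , α⁺≡ , u<N = u , α-shape-step m α⁺≡ , u<N

exempt : ℕ → ℕ → Bool
exempt t a = ((t ≡ᵇ 5) ∧ (a ≡ᵇ 1)) ∨ ((t ≡ᵇ 8) ∧ (a ≡ᵇ 0))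

exempt-cases : ∀ t a → T (exempt t a) → (t ≡ 5 × a ≡ 1) ⊎ (t ≡ 8 × a ≡ 0)
exempt-cases t a e = map (both 5 1) (both 8 0) (to T-∨ e)
  where
  both : ∀ t′ a′ → T ((t ≡ᵇ t′) ∧ (a ≡ᵇ a′)) → t ≡ t′ × a ≡ a′
  both t′ a′ e′ with to T-∧ e′
  ... | t≡ , a≡ = ≡ᵇ⇒≡ t t′ t≡ , ≡ᵇ⇒≡ a a′ a≡

-- Opaque, so that type checking never unfolds this 3226-letter word outside the facts below,
-- which are established by evaluation.
opaque
  A : Word
  A = α 0

  Ainit : Word
  Ainit = take 3224 A

  α0≡A : α 0 ≡ A
  α0≡A = refl

  A-letters : All (_< 4) A
  A-letters = toWitness {a? = all? (_<? 4) A} tt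

  A-squareFree : SquareFree A
  A-squareFree = squareFreeᵇ-sound A refl

  A-greedy : ∀ t a → t < length A → a < A ! t →
             ((t ≡ 5 × a ≡ 1) ⊎ (t ≡ 8 × a ≡ 0)) ⊎ SquareSuffix (take t A ++ a ∷ [])
  A-greedy t a t<L a<At =
    map₁ (exempt-cases t a) (greedyᵇ-sound exempt A refl t a t<L a<At)

  A-take₅ : take 5 A ++ 1 ∷ [] ≡ r₆
  A-take₅ = refl

  A-take₈ : take 8 A ++ 0 ∷ [] ≡ Cinit
  A-take₈ = refl

  A-init : A ≡ Ainit ++ 1 ∷ 2 ∷ []
  A-init = refl

  A-5 : A ! 5 ≡ 3
  A-5 = refl

  A-8 : A ! 8 ≡ 2
  A-8 = refl

  α₁-noStraddle : NoStraddlingSquare ((A ++ shape 4 (Rmid 1) u₁) ++ A) (length (A ++ shape 4 (Rmid 1) u₁))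
  α₁-noStraddle = noStraddleᵇ-sound (A ++ shapeInit 4 (Rmid 1) u₁) A (shape-ends A 4 (Rmid 1) u₁) refl

-- Extensions of α 0 by a word of the shape of α n

module Extension (N : ℕ) (D u : Word) where

  X : Word
  X = block N D u
  Rn : Word
  Rn = ruler N D
  p : Word
  p = A ++ shape N D u
  q : Word
  q = p ++ A

  p′ : Word
  p′ = A ++ shapeInit N D u

  p-ends : p ≡ p′ ++ N ∷ []
  p-ends = shape-ends A N D u

  -- The two exceptions of A-greedy, whose squares reach back into p.
  square-r₆ : SquareSuffix (p ++ r₆)
  square-r₆ = A ++ X ++ Rn ++ C ++ u ++ 2 ∷ [] , D ++ N ∷ r₆ ,
    subst (0 <_) (sym (length-++ D)) (≤-trans (s≤s z≤n) (m≤n+m 7 (length D))) ,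
    ++-solve 7 (λ a u d r c two n →
        (a ⊕ (u ⊕ two ⊕ d ⊕ n) ⊕ (r ⊕ d ⊕ n) ⊕ c ⊕ (u ⊕ two ⊕ d ⊕ n) ⊕ (r ⊕ d ⊕ n)) ⊕ r
      ⊜ (a ⊕ (u ⊕ two ⊕ d ⊕ n) ⊕ (r ⊕ d ⊕ n) ⊕ c ⊕ u ⊕ two) ⊕ (d ⊕ n ⊕ r) ⊕ (d ⊕ n ⊕ r))
      refl A u D r₆ C (2 ∷ []) (N ∷ [])

  square-Cinit : SquareSuffix (p ++ Cinit)
  square-Cinit = Ainit ++ 1 ∷ [] , 2 ∷ X ++ Rn ++ Cinit , s≤s z≤n ,
    trans (cong (λ a → (a ++ shape N D u) ++ Cinit) A-init)
      (++-solve 6 (λ a one two x r c →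
          ((a ⊕ one ⊕ two) ⊕ x ⊕ r ⊕ (c ⊕ two) ⊕ x ⊕ r) ⊕ c
        ⊜ (a ⊕ one) ⊕ (two ⊕ x ⊕ r ⊕ c) ⊕ (two ⊕ x ⊕ r ⊕ c))
        refl Ainit (1 ∷ []) (2 ∷ []) X Rn Cinit)

  greedy-after-p : ∀ t a → t < length A → a < A ! t → SquareSuffix (p ++ take t A ++ a ∷ [])
  greedy-after-p t a t<L a<At with A-greedy t a t<L a<At
  ... | inj₁ (inj₁ (refl , refl)) = subst (λ w → SquareSuffix (p ++ w)) (sym A-take₅) square-r₆
  ... | inj₁ (inj₂ (refl , refl)) = subst (λ w → SquareSuffix (p ++ w)) (sym A-take₈) square-Cinit
  ... | inj₂ square                = squareSuffix-++ˡ p square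

  greedy : GreedyFrom (length p) q
  greedy e a P≤e e<Q a<qe with m≤n⇒∃[o]m+o≡n P≤e
  ... | t , refl = subst SquareSuffix (sym prefix≡)
      (greedy-after-p t a (+-cancelˡ-< (length p) t (length A) (subst (length p + t <_) (length-++ p) e<Q))
                          (subst (a <_) (!-++ʳ p t) a<qe))
    where
    prefix≡ : take (length p + t) q ++ a ∷ [] ≡ p ++ take t A ++ a ∷ []
    prefix≡ = trans (cong (_++ a ∷ []) (take-++ʳ p A t)) (++-assoc p (take t A) (a ∷ []))

  generates : 4 ≤ N → NoStraddlingSquare q (length p) → Generates p q
  generates 4≤N no-straddle = greedy-extension-generates p A
    (squaresWithin-from-marker p A p-ends (All<-weaken 4≤N A-letters) A-squareFree no-straddle)
    greedy

  -- With the letters of u and D below N, the N's of p are exactly the ends of the segments of Q.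
  module _ (4≤N : 4 ≤ N) (u<N : All (_< N) u) (D<N : All (_< N) D) where

    U : Word
    U = u ++ 2 ∷ D
    S₃ : Word
    S₃ = A ++ U
    S₂ : Word
    S₂ = r₆ ++ D
    S₁ : Word
    S₁ = C ++ U
    Q : Word
    Q = S₃ ++ N ∷ S₂ ++ N ∷ S₁ ++ N ∷ S₂ ++ N ∷ A

    q≡Q : q ≡ Q
    q≡Q = ++-solve 7 (λ a u d r c two n →
        (a ⊕ (u ⊕ two ⊕ d ⊕ n) ⊕ (r ⊕ d ⊕ n) ⊕ c ⊕ (u ⊕ two ⊕ d ⊕ n) ⊕ (r ⊕ d ⊕ n)) ⊕ a
      ⊜ (a ⊕ u ⊕ two ⊕ d) ⊕ n ⊕ (r ⊕ d) ⊕ n ⊕ (c ⊕ u ⊕ two ⊕ d) ⊕ n ⊕ (r ⊕ d) ⊕ n ⊕ a)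
      refl A u D r₆ C (2 ∷ []) (N ∷ [])

    p≡ : p ≡ S₃ ++ N ∷ S₂ ++ N ∷ S₁ ++ N ∷ S₂ ++ N ∷ []
    p≡ = ++-solve 7 (λ a u d r c two n →
        a ⊕ (u ⊕ two ⊕ d ⊕ n) ⊕ (r ⊕ d ⊕ n) ⊕ c ⊕ (u ⊕ two ⊕ d ⊕ n) ⊕ (r ⊕ d ⊕ n)
      ⊜ (a ⊕ u ⊕ two ⊕ d) ⊕ n ⊕ (r ⊕ d) ⊕ n ⊕ (c ⊕ u ⊕ two ⊕ d) ⊕ n ⊕ (r ⊕ d) ⊕ n)
      refl A u D r₆ C (2 ∷ []) (N ∷ [])

    L : ℕ
    L = length A
    L′ : ℕ
    L′ = length Ainit
    b : ℕ
    b = length u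
    d : ℕ
    d = length D
    l₃ : ℕ
    l₃ = length S₃
    l₁ : ℕ
    l₁ = length S₁

    length-U : length U ≡ b + suc d
    length-U = length-++ u
    l₃≡ : l₃ ≡ L + (b + suc d)
    l₃≡ = trans (length-++ A) (cong (L +_) length-U)
    l₁≡ : l₁ ≡ 10 + (b + suc d)
    l₁≡ = cong (10 +_) length-U
    L≡ : L ≡ L′ + 2
    L≡ = trans (cong length A-init) (length-++ Ainit)
    l₃≡′ : l₃ ≡ L′ + 2 + (b + suc d)
    l₃≡′ = trans l₃≡ (cong (_+ (b + suc d)) L≡)
    P≡ : length p ≡ l₃ + suc (6 + d + suc (l₁ + suc (6 + d + suc 0)))
    P≡ = trans (cong length p≡) (trans (length-++ S₃) (cong (λ n → l₃ + suc n) (trans (length-++ S₂)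
           (cong (λ n → 6 + d + suc n) (trans (length-++ S₁) (cong (λ n → l₁ + suc n) (length-++ S₂)))))))

    at₃ : ∀ j → Q ! (l₃ + suc j) ≡ (S₂ ++ N ∷ S₁ ++ N ∷ S₂ ++ N ∷ A) ! j
    at₃ j = !-++ʳ S₃ (suc j)
    at₂ : ∀ j → Q ! (l₃ + suc (6 + d + suc j)) ≡ (S₁ ++ N ∷ S₂ ++ N ∷ A) ! j
    at₂ j = trans (at₃ _) (!-++ʳ S₂ (suc j))
    at₁ : ∀ j → Q ! (l₃ + suc (6 + d + suc (l₁ + suc j))) ≡ (S₂ ++ N ∷ A) ! j
    at₁ j = trans (at₂ _) (!-++ʳ S₁ (suc j))

    at-q : ∀ n → q ! n ≡ Q ! n
    at-q n = cong (λ w → w ! n) q≡Q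

    U<N : All (_< N) U
    U<N = ++⁺ u<N (≤-trans (s≤s (s≤s (s≤s z≤n))) 4≤N ∷ D<N)

    S₃<N : All (_< N) S₃
    S₃<N = ++⁺ (All<-weaken 4≤N A-letters) U<N

    S₂<N : All (_< N) S₂
    S₂<N = ++⁺ (All<-weaken (≤-trans (n≤1+n 3) 4≤N) r₆-letters) D<N

    S₁<N : All (_< N) S₁
    S₁<N = ++⁺ (All<-weaken 4≤N C-letters) U<N

    z₀ : ℕ
    z₀ = l₃ + suc (6 + d + suc (l₁ + suc (6 + d)))

    marker-positions : ∀ z → Q ! z ≡ N →
      z ≡ l₃ ⊎ z ≡ l₃ + suc (6 + d) ⊎ z ≡ l₃ + suc (6 + d + suc l₁) ⊎ z₀ ≤ z
    marker-positions z Qz≡N with marker-split S₃ _ z S₃<N Qz≡N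
    ... | inj₁ z≡ = inj₁ z≡
    ... | inj₂ (z₃ , refl , e₃) with marker-split S₂ _ z₃ S₂<N e₃
    ...   | inj₁ refl = inj₂ (inj₁ refl)
    ...   | inj₂ (z₂ , refl , e₂) with marker-split S₁ _ z₂ S₁<N e₂
    ...     | inj₁ refl = inj₂ (inj₂ (inj₁ refl))
    ...     | inj₂ (z₁ , refl , e₁) with marker-split S₂ _ z₁ S₂<N e₁
    ...       | inj₁ refl = inj₂ (inj₂ (inj₂ ≤-refl))
    ...       | inj₂ (z′ , refl , _) =
      inj₂ (inj₂ (inj₂ (+-monoʳ-≤ l₃ (s≤s (+-monoʳ-≤ (6 + d) (s≤s (+-monoʳ-≤ l₁ (s≤s (m≤m+n (6 + d) (suc z′))))))))))

    in-A : ∀ j → q ! (length p + j) ≡ A ! j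
    in-A j = !-++ʳ p j

    one-in-r₆ : q ! (l₃ + suc 5) ≡ 1
    one-in-r₆ = trans (at-q _) (at₃ 5)

    zero-in-C : q ! (l₃ + suc (6 + d + suc 8)) ≡ 0
    zero-in-C = trans (at-q _) (at₂ 8)

    one-in-last-r₆ : q ! (l₃ + suc (6 + d + suc (l₁ + suc 5))) ≡ 1
    one-in-last-r₆ = trans (at-q _) (at₁ 5)

    two-in-S₃ : q ! (L + b) ≡ 2
    two-in-S₃ = begin
      q ! (L + b)             ≡⟨ at-q _ ⟩
      Q ! (L + b)             ≡⟨ !-++ˡ S₃ (subst (L + b <_) (sym l₃≡) (+-monoʳ-< L (m<m+n b z<s))) ⟩
      S₃ ! (L + b)            ≡⟨ !-++ʳ A b ⟩
      U ! b                   ≡⟨ !-++-∷ u ⟩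
      2                       ∎
      where open ≡-Reasoning

    two-in-S₁ : q ! (l₃ + suc (6 + d + suc (10 + b))) ≡ 2
    two-in-S₁ = begin
      q ! (l₃ + suc (6 + d + suc (10 + b)))  ≡⟨ trans (at-q _) (at₂ (10 + b)) ⟩
      (U ++ N ∷ S₂ ++ N ∷ A) ! b             ≡⟨ !-++ˡ U (subst (b <_) (sym length-U) (m<m+n b z<s)) ⟩
      U ! b                                  ≡⟨ !-++-∷ u ⟩
      2                                      ∎
      where open ≡-Reasoning

    one-in-A : q ! L′ ≡ 1
    one-in-A = begin
      q ! L′                     ≡⟨ at-q _ ⟩
      Q ! L′                     ≡⟨ !-++ˡ S₃ (<-≤-trans L′<L (subst (L ≤_) (sym (length-++ A)) (m≤m+n L (length U)))) ⟩
      S₃ ! L′                    ≡⟨ !-++ˡ A L′<L ⟩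
      A ! L′                     ≡⟨ cong (λ w → w ! L′) A-init ⟩
      (Ainit ++ 1 ∷ 2 ∷ []) ! L′ ≡⟨ !-++-∷ Ainit ⟩
      1                          ∎
      where
      open ≡-Reasoning
      L′<L : L′ < L
      L′<L = subst (L′ <_) (sym L≡) (m<m+n L′ z<s)

    half-length : ∀ {z k κ} → z + suc k ≡ length p → length p ≡ z + suc κ → k ≡ κ
    half-length {z} z+1+k≡P P≡z+1+κ = suc-injective (+-cancelˡ-≡ z _ _ (trans z+1+k≡P P≡z+1+κ))

    no-partner-after-S₃ : ∀ {i k} → SquareAt (q !_) i k → i ≤ l₃ → l₃ + suc k ≡ length p → length p < i + (k + k) → ⊥
    no-partner-after-S₃ {i} {k} square i≤z z+1+k≡P P<end =
      straddle-refute {q !_} square i≤z z+1+k≡P P<end 5 after≢ (L + b) d before≡ room before≢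
      where
      k≡ : k ≡ 6 + d + suc (l₁ + suc (6 + d + suc 0))
      k≡ = half-length z+1+k≡P P≡
      after≢ : q ! (l₃ + suc 5) ≢ q ! (length p + 5)
      after≢ = ≢-via one-in-r₆ (trans (in-A 5) A-5) λ ()
      before≡ : L + b + suc d ≡ l₃
      before≡ = trans (+-assoc L b (suc d)) (sym l₃≡)
      room : 5 + d + 2 ≤ k
      room = subst (5 + d + 2 ≤_) (sym k≡) (≤-by (l₁ + suc (6 + d + suc 0)) (regroup d l₁))
        where
        regroup : ∀ d l₁ → 5 + d + 2 + (l₁ + suc (6 + d + suc 0)) ≡ 6 + d + suc (l₁ + suc (6 + d + suc 0))
        regroup = solve-∀
      before≢ : q ! (L + b) ≢ q ! (L + b + k)
      before≢ = ≢-via two-in-S₃ (trans (cong (q !_) partner) one-in-last-r₆) λ ()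
        where
        regroup : ∀ L b d l₁ → L + b + (6 + d + suc (l₁ + suc (6 + d + suc 0))) ≡ L + (b + suc d) + suc (6 + d + suc (l₁ + suc 5))
        regroup = solve-∀
        partner : L + b + k ≡ l₃ + suc (6 + d + suc (l₁ + suc 5))
        partner = trans (cong (L + b +_) k≡) (trans (regroup L b d l₁) (cong (_+ suc (6 + d + suc (l₁ + suc 5))) (sym l₃≡)))

    no-partner-after-S₂ : ∀ {i k} → SquareAt (q !_) i k → i ≤ l₃ + suc (6 + d) → l₃ + suc (6 + d) + suc k ≡ length p →
                length p < i + (k + k) → ⊥
    no-partner-after-S₂ {i} {k} square i≤z z+1+k≡P P<end =
      straddle-refute {q !_} square i≤z z+1+k≡P P<end 8 after≢ L′ b′ before≡ room before≢
      where
      b′ : ℕ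
      b′ = 1 + (b + suc d) + suc (6 + d)
      k≡ : k ≡ l₁ + suc (6 + d + suc 0)
      k≡ = half-length z+1+k≡P (trans P≡ (regroup l₃ d l₁))
        where
        regroup : ∀ l₃ d l₁ → l₃ + suc (6 + d + suc (l₁ + suc (6 + d + suc 0)))
                            ≡ l₃ + suc (6 + d) + suc (l₁ + suc (6 + d + suc 0))
        regroup = solve-∀
      after≢ : q ! (l₃ + suc (6 + d) + suc 8) ≢ q ! (length p + 8)
      after≢ = ≢-via (trans (cong (q !_) (regroup l₃ d)) zero-in-C) (trans (in-A 8) A-8) λ ()
        where
        regroup : ∀ l₃ d → l₃ + suc (6 + d) + suc 8 ≡ l₃ + suc (6 + d + suc 8)
        regroup = solve-∀
      before≡ : L′ + suc b′ ≡ l₃ + suc (6 + d)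
      before≡ = trans (regroup L′ b d) (cong (λ n → n + suc (6 + d)) (sym l₃≡′))
        where
        regroup : ∀ L′ b d → L′ + suc (1 + (b + suc d) + suc (6 + d)) ≡ L′ + 2 + (b + suc d) + suc (6 + d)
        regroup = solve-∀
      room : 8 + b′ + 2 ≤ k
      room = ≤-reflexive (trans (regroup b d) (trans (cong (λ n → n + suc (6 + d + suc 0)) (sym l₁≡)) (sym k≡)))
        where
        regroup : ∀ b d → 8 + (1 + (b + suc d) + suc (6 + d)) + 2 ≡ 10 + (b + suc d) + suc (6 + d + suc 0)
        regroup = solve-∀
      before≢ : q ! L′ ≢ q ! (L′ + k)
      before≢ = ≢-via one-in-A (trans (cong (q !_) partner) zero-in-C) λ ()
        where
        regroup : ∀ L′ b d → L′ + (10 + (b + suc d) + suc (6 + d + suc 0)) ≡ L′ + 2 + (b + suc d) + suc (6 + d + suc 8)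
        regroup = solve-∀
        partner : L′ + k ≡ l₃ + suc (6 + d + suc 8)
        partner = trans (cong (L′ +_) (trans k≡ (cong (_+ suc (6 + d + suc 0)) l₁≡)))
                    (trans (regroup L′ b d) (cong (_+ suc (6 + d + suc 8)) (sym l₃≡′)))

    no-partner-after-S₁ : ∀ {i k} → SquareAt (q !_) i k → i ≤ l₃ + suc (6 + d + suc l₁) →
                l₃ + suc (6 + d + suc l₁) + suc k ≡ length p → length p < i + (k + k) → ⊥
    no-partner-after-S₁ {i} {k} square i≤z z+1+k≡P P<end =
      straddle-refute {q !_} square i≤z z+1+k≡P P<end 5 after≢ j d before≡ room before≢
      where
      j : ℕ
      j = l₃ + suc (6 + d + suc (10 + b))
      k≡ : k ≡ 6 + d + suc 0
      k≡ = half-length z+1+k≡P (trans P≡ (regroup l₃ d l₁))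
        where
        regroup : ∀ l₃ d l₁ → l₃ + suc (6 + d + suc (l₁ + suc (6 + d + suc 0)))
                            ≡ l₃ + suc (6 + d + suc l₁) + suc (6 + d + suc 0)
        regroup = solve-∀
      after≢ : q ! (l₃ + suc (6 + d + suc l₁) + suc 5) ≢ q ! (length p + 5)
      after≢ = ≢-via (trans (cong (q !_) (regroup l₃ d l₁)) one-in-last-r₆) (trans (in-A 5) A-5) λ ()
        where
        regroup : ∀ l₃ d l₁ → l₃ + suc (6 + d + suc l₁) + suc 5 ≡ l₃ + suc (6 + d + suc (l₁ + suc 5))
        regroup = solve-∀
      before≡ : j + suc d ≡ l₃ + suc (6 + d + suc l₁)
      before≡ = trans (regroup l₃ d b) (cong (λ n → l₃ + suc (6 + d + suc n)) (sym l₁≡))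
        where
        regroup : ∀ l₃ d b → l₃ + suc (6 + d + suc (10 + b)) + suc d ≡ l₃ + suc (6 + d + suc (10 + (b + suc d)))
        regroup = solve-∀
      room : 5 + d + 2 ≤ k
      room = ≤-reflexive (trans (regroup d) (sym k≡))
        where
        regroup : ∀ d → 5 + d + 2 ≡ 6 + d + suc 0
        regroup = solve-∀
      before≢ : q ! j ≢ q ! (j + k)
      before≢ = ≢-via two-in-S₁ (trans (cong (q !_) partner) one-in-last-r₆) λ ()
        where
        regroup : ∀ l₃ d b → l₃ + suc (6 + d + suc (10 + b)) + (6 + d + suc 0)
                           ≡ l₃ + suc (6 + d + suc (10 + (b + suc d) + suc 5))
        regroup = solve-∀
        partner : j + k ≡ l₃ + suc (6 + d + suc (l₁ + suc 5))
        partner = trans (cong (j +_) k≡) (trans (regroup l₃ d b) (cong (λ n → l₃ + suc (6 + d + suc (n + suc 5))) (sym l₁≡)))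

    no-straddle : NoStraddlingSquare q (length p)
    no-straddle i k square i+k<P P<end _ with straddle-marker p A p-ends square i+k<P P<end
    ... | z , i≤z , z+1+k≡P , qz≡N with marker-positions z (trans (sym (at-q z)) qz≡N)
    ... | inj₁ refl                = no-partner-after-S₃ square i≤z z+1+k≡P P<end
    ... | inj₂ (inj₁ refl)         = no-partner-after-S₂ square i≤z z+1+k≡P P<end
    ... | inj₂ (inj₂ (inj₁ refl))  = no-partner-after-S₁ square i≤z z+1+k≡P P<end
    ... | inj₂ (inj₂ (inj₂ z₀≤z))  = <-irrefl refl (begin-strict
      length p      ≡⟨ trans P≡ (last-marker l₃ d l₁) ⟩
      suc z₀        ≤⟨ s≤s z₀≤z ⟩
      suc z         <⟨ m<m+n (suc z) (proj₁ square) ⟩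
      suc z + k     ≡⟨ sym (+-suc z k) ⟩
      z + suc k     ≡⟨ z+1+k≡P ⟩
      length p      ∎)
      where
      open ≤-Reasoning
      last-marker : ∀ l₃ d l₁ → l₃ + suc (6 + d + suc (l₁ + suc (6 + d + suc 0)))
                              ≡ suc (l₃ + suc (6 + d + suc (l₁ + suc (6 + d))))
      last-marker = solve-∀

generates-after-A : ∀ n → 0 < n → Generates (A ++ α n) ((A ++ α n) ++ A)
generates-after-A (suc zero) _ =
  subst (λ w → Generates (A ++ w) ((A ++ w) ++ A)) (sym α₁-shape)
    (Extension.generates 4 (Rmid 1) u₁ ≤-refl α₁-noStraddle)
generates-after-A (suc (suc m)) _ with α-shape m
... | u , α≡ , u<N = subst (λ w → Generates (A ++ w) ((A ++ w) ++ A)) (sym α≡)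
    (Extension.generates N D u 4≤N (Extension.no-straddle N D u 4≤N u<N (Rmid-letters (2 + m))))
  where
  N : ℕ
  N = 5 + m
  D : Word
  D = Rmid (2 + m)
  4≤N : 4 ≤ N
  4≤N = m≤m+n 4 (suc m)

theorem4p16 : ∀ (n : ℕ) → 0 < n →
    Generates (apply α (0 ∷ n ∷ [])) (apply α (0 ∷ n ∷ 0 ∷ []))
theorem4p16 n 0<n = subst₂ Generates (sym αₙ-after-α₀) (sym α₀αₙα₀) (generates-after-A n 0<n)
  where
  αₙ-after-α₀ : apply α (0 ∷ n ∷ []) ≡ A ++ α n
  αₙ-after-α₀ = cong₂ _++_ α0≡A (++-identityʳ (α n))
  α₀αₙα₀ : apply α (0 ∷ n ∷ 0 ∷ []) ≡ (A ++ α n) ++ A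
  α₀αₙα₀ = trans (cong₂ (λ a w → a ++ α n ++ w) α0≡A (trans (++-identityʳ (α 0)) α0≡A)) (sym (++-assoc A (α n) A))
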